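{- Let $r\geq 3$ be an integer and $c>0$ a real number. If $G$ is a graph of order $n$ with \[ e(G)>\left(\frac{r-1}{2r}+c\right)n^{2}, \] then \[ k_{r+1}(G)>2c\,\frac{r}{r+1}\left(\frac{n}{r}\right)^{r+1} \qquad\text{and}\qquad js^{(2,r+1,2)}(G)>2c\left(\frac{n}{r}\right)^{r-1}. \]
   Context: All graphs are finite and simple. $e(G)$ is the number of edges of $G$. $k_{s}(G)$ denotes the number of $s$-cliques (complete subgraphs on $s$ vertices) of $G$. For a graph $G$, $js^{(2,r+1,2)}(G)$ (the $(2,r+1,2)$-jointsize) is the maximum, over all edges $uv$ of $G$, of the number of $(r+1)$-cliques of $G$ containing both $u$ and $v$ (and $0$ if $G$ has no edges).
   Formalization: The constant c ranges over the positive rationals rather than over all positive real numbers. -}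

module Defs where

open import Data.Bool using (Bool; true; false; _∧_; _∨_; not; if_then_else_)
open import Data.Nat as ℕ using (ℕ; zero; suc; _∸_; _⊔_; _<ᵇ_; _≡ᵇ_)
open import Data.Integer using (+_)
open import Data.Fin using (Fin; toℕ; _≟_)
open import Data.Fin.Subset using (Subset; _∈_; ∣_∣)
open import Data.Vec using (Vec; []; _∷_; lookup)
open import Data.List using (List; []; _∷_; map; concatMap; foldr; allFin)
open import Data.Nat.ListAction using (sum)
open import Data.Bool.ListAction using (and)
open import Data.Product using (_×_; _,_)
open import Data.Rational using (ℚ; _/_; 1ℚ; _*_)
open import Relation.Nullary.Decidable using (⌊_⌋)
open import Relation.Binary.PropositionalEquality using (_≡_)

record Graph (n : ℕ) : Set where
  field
    adj    : Fin n → Fin n → Bool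
    sym    : ∀ i j → adj i j ≡ adj j i
    irrefl : ∀ i → adj i i ≡ false
open Graph public

allSubsets : (n : ℕ) → List (Subset n)
allSubsets zero = [] ∷ []
allSubsets (suc n) = concatMap (λ s → (true ∷ s) ∷ (false ∷ s) ∷ []) (allSubsets n)

countᵇ : ∀ {A : Set} → (A → Bool) → List A → ℕ
countᵇ p xs = sum (map (λ x → if p x then 1 else 0) xs)

allPairs : (n : ℕ) → List (Fin n × Fin n)
allPairs n = concatMap (λ i → map (λ j → (i , j)) (allFin n)) (allFin n)

e : ∀ {n} → Graph n → ℕ
e {n} G = countᵇ (λ { (i , j) → (toℕ i <ᵇ toℕ j) ∧ adj G i j }) (allPairs n)

isCliqueᵇ : ∀ {n} → Graph n → Subset n → Bool
isCliqueᵇ {n} G p =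
  and (map (λ { (i , j) → not (lookup p i ∧ lookup p j ∧ not ⌊ i ≟ j ⌋) ∨ adj G i j })
           (allPairs n))

k : ∀ {n} → ℕ → Graph n → ℕ
k {n} s G = countᵇ (λ p → (∣ p ∣ ≡ᵇ s) ∧ isCliqueᵇ G p) (allSubsets n)

kThrough : ∀ {n} → ℕ → Graph n → Fin n → Fin n → ℕ
kThrough {n} s G u v =
  countᵇ (λ p → (∣ p ∣ ≡ᵇ s) ∧ isCliqueᵇ G p ∧ lookup p u ∧ lookup p v) (allSubsets n)

-- js^{(2,s,2)}(G): max over edges uv of the number of s-cliques containing u and v
-- (0 if G has no edges)
js : ∀ {n} → ℕ → Graph n → ℕ
js {n} s G =
  foldr _⊔_ 0 (map (λ { (u , v) → if adj G u v then kThrough s G u v else 0 }) (allPairs n))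

-- rational a / b (convention: 0 when b = 0; only used with b ≠ 0)
frac : ℕ → ℕ → ℚ
frac a zero = + 0 / 1
frac a (suc b) = + a / suc b

_^ℚ_ : ℚ → ℕ → ℚ
q ^ℚ zero = 1ℚ
q ^ℚ suc m = q * (q ^ℚ m)
infixr 8 _^ℚ_

module Submission where

-- Write kⱼ for the number of j-cliques of G. Counting cliques in vertex neighbourhoods and
-- applying the Cauchy–Schwarz inequality gives the Moon–Moser inequality
--   (j+1)² kⱼ₊₁² ≤ j(j+2) kⱼ₊₂ kⱼ + n kⱼ₊₁ kⱼ,
-- from which induction on j yields 2(j+1) e kⱼ₊₁ ≤ (j+2) n kⱼ₊₂ + j n² kⱼ₊₁. When
-- 2re ≥ (r−1)n², this bounds every ratio kⱼ₊₁/kⱼ from below, so that kᵣ ≥ (n/r)ʳ, and for the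
-- excess D = 2re − (r−1)n² > 2rcn² it gives D kᵣ ≤ (r+1) n kᵣ₊₁. Together these yield
-- kᵣ₊₁ > 2c n^(r+1) / ((r+1) r^(r−1)). Finally, every (r+1)-clique contains (r+1)r ordered
-- adjacent pairs, so (r+1) r kᵣ₊₁ ≤ js · 2e ≤ js · n².

module Sums where

  open import Data.Bool using (Bool; true; false; _∧_; if_then_else_)
  open import Data.Nat using (ℕ; _+_; _*_; _≤_; z≤n; _⊔_)
  open import Data.Nat.Properties
  open import Data.Nat.ListAction using (sum)
  open import Data.Nat.ListAction.Properties using (sum-++)
  open import Data.List using (List; []; _∷_; _++_; length; map; filterᵇ; foldr)
  open import Data.List.Properties using (map-++)
  open import Algebra.Properties.CommutativeSemigroup +-commutativeSemigroup using (interchange)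
  open import Relation.Binary.PropositionalEquality

  when : Bool → ℕ → ℕ
  when b x = if b then x else 0

  when-* : ∀ b m → when b m ≡ m * when b 1
  when-* true  m = sym (*-identityʳ m)
  when-* false m = sym (*-zeroʳ m)

  -- Via sum ∘ map, so that countᵇ p xs is definitionally ∑ xs (λ x → when (p x) 1).
  ∑ : {B : Set} → List B → (B → ℕ) → ℕ
  ∑ xs f = sum (map f xs)

  module _ {B : Set} where

    ∑-cong : (V : List B) {f g : B → ℕ} → (∀ x → f x ≡ g x) → ∑ V f ≡ ∑ V g
    ∑-cong []      f≗g = refl
    ∑-cong (x ∷ V) f≗g = cong₂ _+_ (f≗g x) (∑-cong V f≗g)

    ∑-mono-≤ : (V : List B) {f g : B → ℕ} → (∀ x → f x ≤ g x) → ∑ V f ≤ ∑ V g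
    ∑-mono-≤ []      f≤g = z≤n
    ∑-mono-≤ (x ∷ V) f≤g = +-mono-≤ (f≤g x) (∑-mono-≤ V f≤g)

    ∑-+ : (V : List B) (f g : B → ℕ) → ∑ V (λ x → f x + g x) ≡ ∑ V f + ∑ V g
    ∑-+ []      f g = refl
    ∑-+ (x ∷ V) f g = trans (cong (f x + g x +_) (∑-+ V f g)) (interchange (f x) (g x) _ _)

    ∑-*ˡ : (V : List B) (c : ℕ) (f : B → ℕ) → ∑ V (λ x → c * f x) ≡ c * ∑ V f
    ∑-*ˡ []      c f = sym (*-zeroʳ c)
    ∑-*ˡ (x ∷ V) c f = trans (cong (c * f x +_) (∑-*ˡ V c f)) (sym (*-distribˡ-+ c (f x) (∑ V f)))

    ∑-const : (V : List B) (c : ℕ) → ∑ V (λ _ → c) ≡ length V * c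
    ∑-const []      c = refl
    ∑-const (x ∷ V) c = cong (c +_) (∑-const V c)

    ∑-++ : (U V : List B) (f : B → ℕ) → ∑ (U ++ V) f ≡ ∑ U f + ∑ V f
    ∑-++ U V f = trans (cong sum (map-++ f U V)) (sum-++ (map f U) (map f V))

    ∑-filterᵇ : (V : List B) (p : B → Bool) (f : B → ℕ) →
                ∑ (filterᵇ p V) f ≡ ∑ V (λ x → when (p x) (f x))
    ∑-filterᵇ []      p f = refl
    ∑-filterᵇ (x ∷ V) p f with p x
    ... | true  = cong (f x +_) (∑-filterᵇ V p f)
    ... | false = ∑-filterᵇ V p f

    ∑-when-const : (V : List B) (p : B → Bool) (c : ℕ) →
                   ∑ V (λ x → when (p x) c) ≡ length (filterᵇ p V) * c
    ∑-when-const V p c = trans (sym (∑-filterᵇ V p (λ _ → c))) (∑-const (filterᵇ p V) c)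

    filterᵇ-comm : (p q : B → Bool) (V : List B) →
                   filterᵇ p (filterᵇ q V) ≡ filterᵇ q (filterᵇ p V)
    filterᵇ-comm p q []      = refl
    filterᵇ-comm p q (x ∷ V) with q x in qx | p x in px
    ... | true  | true  rewrite qx | px = cong (x ∷_) (filterᵇ-comm p q V)
    ... | true  | false rewrite px      = filterᵇ-comm p q V
    ... | false | true  rewrite qx      = filterᵇ-comm p q V
    ... | false | false                 = filterᵇ-comm p q V

    filterᵇ-∧ : (p q : B → Bool) (V : List B) →
                filterᵇ p (filterᵇ q V) ≡ filterᵇ (λ x → q x ∧ p x) V
    filterᵇ-∧ p q []      = refl
    filterᵇ-∧ p q (x ∷ V) with q x | p x in px
    ... | true  | true  rewrite px = cong (x ∷_) (filterᵇ-∧ p q V)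
    ... | true  | false rewrite px = filterᵇ-∧ p q V
    ... | false | _                = filterᵇ-∧ p q V

  module _ {B C : Set} where

    ∑-swap : (V : List B) (W : List C) (f : B → C → ℕ) →
             ∑ V (λ v → ∑ W (f v)) ≡ ∑ W (λ w → ∑ V (λ v → f v w))
    ∑-swap []      W f = sym (trans (∑-const W 0) (*-zeroʳ (length W)))
    ∑-swap (x ∷ V) W f = trans (cong (∑ W (f x) +_) (∑-swap V W f)) (sym (∑-+ W (f x) _))

    ∑-map : (V : List B) (g : B → C) (f : C → ℕ) → ∑ (map g V) f ≡ ∑ V (λ x → f (g x))
    ∑-map []      g f = refl
    ∑-map (x ∷ V) g f = cong (f (g x) +_) (∑-map V g f)

    filterᵇ-map : (p : C → Bool) (g : B → C) (V : List B) →
                  filterᵇ p (map g V) ≡ map g (filterᵇ (λ x → p (g x)) V)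
    filterᵇ-map p g []      = refl
    filterᵇ-map p g (x ∷ V) with p (g x)
    ... | true  = cong (g x ∷_) (filterᵇ-map p g V)
    ... | false = filterᵇ-map p g V

  ∑-≤-max : {X : Set} (L : List X) (g c : X → ℕ) (M : ℕ) → foldr _⊔_ 0 (map g L) ≤ M →
            (∀ x → g x ≤ M → g x ≤ c x) → ∑ L g ≤ ∑ L c
  ∑-≤-max []      g c M _   _   = z≤n
  ∑-≤-max (x ∷ L) g c M max≤ g≤c =
    +-mono-≤ (g≤c x (≤-trans (m≤m⊔n (g x) _) max≤)) (∑-≤-max L g c M (≤-trans (m≤n⊔m (g x) _) max≤) g≤c)

module Inequalities where

  open import Data.Nat using (ℕ; zero; suc; _+_; _*_; _∸_; _^_; _!; _≤_; _≤?_; z≤n)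
  open import Data.Nat.Properties
  open import Data.List using (List; []; _∷_)
  open import Data.Sum using (inj₁; inj₂)
  open import Relation.Binary.PropositionalEquality
  open import Relation.Nullary using (yes; no)
  open import Relation.Nullary.Negation using (contradiction)
  open import Data.Nat.Tactic.RingSolver using (solve-∀; solve)
  open Sums

  m*m≤n*n⇒m≤n : ∀ m n → m * m ≤ n * n → m ≤ n
  m*m≤n*n⇒m≤n m n m²≤n² with m ≤? n
  ... | yes m≤n = m≤n
  ... | no  m≰n = contradiction m²≤n² (<⇒≱ (*-mono-< (≰⇒> m≰n) (≰⇒> m≰n)))

  4mn≤[m+n]²-ordered : ∀ {m n} → m ≤ n → 4 * (m * n) ≤ (m + n) * (m + n)
  4mn≤[m+n]²-ordered {m} {n} m≤n =
    subst (λ n → 4 * (m * n) ≤ (m + n) * (m + n)) (m+[n∸m]≡n m≤n)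
      (subst (4 * (m * (m + d)) ≤_) (square-gap m d) (m≤m+n _ (d * d)))
    where
      d = n ∸ m
      square-gap : ∀ m d → 4 * (m * (m + d)) + d * d ≡ (m + (m + d)) * (m + (m + d))
      square-gap = solve-∀

  4mn≤[m+n]² : ∀ m n → 4 * (m * n) ≤ (m + n) * (m + n)
  4mn≤[m+n]² m n with ≤-total m n
  ... | inj₁ m≤n = 4mn≤[m+n]²-ordered m≤n
  ... | inj₂ n≤m = subst₂ _≤_ (cong (4 *_) (*-comm n m)) (cong (λ s → s * s) (+-comm n m))
                     (4mn≤[m+n]²-ordered n≤m)

  am-gm : ∀ x y z → z * z ≤ x * y → 2 * z ≤ x + y
  am-gm x y z z²≤xy = m*m≤n*n⇒m≤n (2 * z) (x + y) (begin
      2 * z * (2 * z)   ≡⟨ solve (z ∷ []) ⟩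
      4 * (z * z)       ≤⟨ *-monoʳ-≤ 4 z²≤xy ⟩
      4 * (x * y)       ≤⟨ 4mn≤[m+n]² x y ⟩
      (x + y) * (x + y) ∎)
    where open ≤-Reasoning

  cauchy-schwarz-+ : ∀ c x X b B y Y → c * (x * x) ≤ b * y → c * (X * X) ≤ B * Y →
                     c * ((x + X) * (x + X)) ≤ (b + B) * (y + Y)
  cauchy-schwarz-+ c x X b B y Y hx hX = begin
      c * ((x + X) * (x + X))                       ≡⟨ solve (c ∷ x ∷ X ∷ []) ⟩
      c * (x * x) + (2 * (c * x * X) + c * (X * X)) ≤⟨ +-mono-≤ hx (+-mono-≤ cross hX) ⟩
      b * y + ((b * Y + B * y) + B * Y)             ≡⟨ solve (b ∷ B ∷ y ∷ Y ∷ []) ⟩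
      (b + B) * (y + Y)                             ∎
    where
      open ≤-Reasoning
      cross : 2 * (c * x * X) ≤ b * Y + B * y
      cross = am-gm (b * Y) (B * y) (c * x * X) (begin
        (c * x * X) * (c * x * X)     ≡⟨ solve (c ∷ x ∷ X ∷ []) ⟩
        (c * (x * x)) * (c * (X * X)) ≤⟨ *-mono-≤ hx hX ⟩
        (b * y) * (B * Y)             ≡⟨ solve (b ∷ B ∷ y ∷ Y ∷ []) ⟩
        (b * Y) * (B * y)             ∎)

  ∑-cauchy-schwarz : {B : Set} (V : List B) (c : ℕ) (a b y : B → ℕ) →
                     (∀ v → c * (a v * a v) ≤ b v * y v) → c * (∑ V a * ∑ V a) ≤ ∑ V b * ∑ V y
  ∑-cauchy-schwarz []      c a b y h = ≤-reflexive (*-zeroʳ c)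
  ∑-cauchy-schwarz (v ∷ V) c a b y h =
    cauchy-schwarz-+ c (a v) _ (b v) _ (y v) _ (h v) (∑-cauchy-schwarz V c a b y h)

  -- In the next three lemmas E stands for the number of edges and Kᵢ for the number of
  -- (j+i)-cliques of an n-vertex graph.
  edge-clique-step : ∀ j n E K₁ K₂ K₃ →
    2 * suc j * (E * K₁) ≤ suc (suc j) * (n * K₂) + j * (n * n * K₁) →
    suc (suc j) * suc (suc j) * (K₂ * K₂) ≤ suc j * suc (suc (suc j)) * (K₃ * K₁) + n * (K₂ * K₁) →
    (K₁ ≡ 0 → K₂ ≡ 0) →
    2 * suc (suc j) * (E * K₂) ≤ suc (suc (suc j)) * (n * K₃) + suc j * (n * n * K₂)
  edge-clique-step j n E zero K₂ K₃ _ _ K₂≡0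
    rewrite K₂≡0 refl | *-zeroʳ E | *-zeroʳ (2 * suc (suc j)) = z≤n
  edge-clique-step j n E (suc k) K₂ K₃ hyp₁ hyp₂ _ = *-cancelˡ-≤ (suc j * suc k) (begin
      suc j * suc k * (2 * suc (suc j) * (E * K₂))
        ≡⟨ solve (j ∷ k ∷ E ∷ K₂ ∷ []) ⟩
      suc (suc j) * K₂ * (2 * suc j * (E * suc k))
        ≤⟨ *-monoʳ-≤ (suc (suc j) * K₂) hyp₁ ⟩
      suc (suc j) * K₂ * (suc (suc j) * (n * K₂) + j * (n * n * suc k))
        ≡⟨ solve (j ∷ k ∷ n ∷ K₂ ∷ []) ⟩
      n * (suc (suc j) * suc (suc j) * (K₂ * K₂)) + j * suc (suc j) * (n * n * (suc k * K₂))
        ≤⟨ +-monoˡ-≤ _ (*-monoʳ-≤ n hyp₂) ⟩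
      n * (suc j * suc (suc (suc j)) * (K₃ * suc k) + n * (K₂ * suc k)) + j * suc (suc j) * (n * n * (suc k * K₂))
        ≡⟨ solve (j ∷ k ∷ n ∷ K₂ ∷ K₃ ∷ []) ⟩
      suc j * suc k * (suc (suc (suc j)) * (n * K₃) + suc j * (n * n * K₂))
        ∎)
    where open ≤-Reasoning

  clique-ratio : ∀ j m n E K₁ K₂ →
    (suc j + m) * (n * n) ≤ 2 * (suc (suc j) + m) * E →
    2 * suc j * (E * K₁) ≤ suc (suc j) * (n * K₂) + j * (n * n * K₁) →
    suc m * (n * K₁) ≤ (suc (suc j) + m) * suc (suc j) * K₂
  clique-ratio j m zero     E K₁ K₂ _ _ rewrite *-zeroʳ (suc m) = z≤n
  clique-ratio j m (suc n) E K₁ K₂ density hyp =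
    *-cancelˡ-≤ (suc n) (+-cancelʳ-≤ ((suc (suc j) + m) * (j * (suc n * suc n * K₁))) _ _ (begin
      suc n * (suc m * (suc n * K₁)) + (suc (suc j) + m) * (j * (suc n * suc n * K₁))
        ≡⟨ solve (j ∷ m ∷ n ∷ K₁ ∷ []) ⟩
      suc j * ((suc j + m) * (suc n * suc n)) * K₁
        ≤⟨ *-monoˡ-≤ K₁ (*-monoʳ-≤ (suc j) density) ⟩
      suc j * (2 * (suc (suc j) + m) * E) * K₁
        ≡⟨ solve (j ∷ m ∷ E ∷ K₁ ∷ []) ⟩
      (suc (suc j) + m) * (2 * suc j * (E * K₁))
        ≤⟨ *-monoʳ-≤ (suc (suc j) + m) hyp ⟩
      (suc (suc j) + m) * (suc (suc j) * (suc n * K₂) + j * (suc n * suc n * K₁))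
        ≡⟨ *-distribˡ-+ (suc (suc j) + m) (suc (suc j) * (suc n * K₂)) (j * (suc n * suc n * K₁)) ⟩
      (suc (suc j) + m) * (suc (suc j) * (suc n * K₂)) + (suc (suc j) + m) * (j * (suc n * suc n * K₁))
        ≡⟨ cong (_+ (suc (suc j) + m) * (j * (suc n * suc n * K₁))) (rearrange (suc (suc j) + m) (suc (suc j)) (suc n) K₂) ⟩
      suc n * ((suc (suc j) + m) * suc (suc j) * K₂) + (suc (suc j) + m) * (j * (suc n * suc n * K₁))
        ∎))
    where
      open ≤-Reasoning
      rearrange : ∀ R s n K → R * (s * (n * K)) ≡ n * (R * s * K)
      rearrange = solve-∀

  -- Multiplies the ratio bounds kₛ₊₁ ≥ (r−s) n kₛ / (r (s+1)) for s < r; the factorials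
  -- collect the products of the factors r−s and s+1.
  clique-ratio-product : (K : ℕ → ℕ) (r n : ℕ) → K 0 ≡ 1 →
    (∀ s m → suc s + m ≡ r → suc m * (n * K s) ≤ r * suc s * K (suc s)) →
    ∀ s m → s + m ≡ r → n ^ s * r ! ≤ r ^ s * (s ! * (m ! * K s))
  clique-ratio-product K r n K₀≡1 ratio zero m refl rewrite K₀≡1 = ≤-reflexive (unit (r !))
    where
      unit : ∀ x → 1 * x ≡ 1 * (1 * (x * 1))
      unit = solve-∀
  clique-ratio-product K r n K₀≡1 ratio (suc s) m s+m≡r = begin
      n * n ^ s * r !
        ≡⟨ *-assoc n (n ^ s) (r !) ⟩
      n * (n ^ s * r !)
        ≤⟨ *-monoʳ-≤ n (clique-ratio-product K r n K₀≡1 ratio s (suc m) (trans (+-suc s m) s+m≡r)) ⟩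
      n * (r ^ s * (s ! * ((suc m * m !) * K s)))
        ≡⟨ shuffle₁ n (r ^ s) (s !) (m !) m (K s) ⟩
      r ^ s * (s ! * (m ! * (suc m * (n * K s))))
        ≤⟨ *-monoʳ-≤ (r ^ s) (*-monoʳ-≤ (s !) (*-monoʳ-≤ (m !) (ratio s m s+m≡r))) ⟩
      r ^ s * (s ! * (m ! * (r * suc s * K (suc s))))
        ≡⟨ shuffle₂ r (r ^ s) (s !) (m !) s (K (suc s)) ⟩
      r * r ^ s * ((suc s * s !) * (m ! * K (suc s)))
        ∎
    where
      open ≤-Reasoning
      shuffle₁ : ∀ n P F G m K → n * (P * (F * ((suc m * G) * K))) ≡ P * (F * (G * (suc m * (n * K))))
      shuffle₁ = solve-∀
      shuffle₂ : ∀ r P F G s K → P * (F * (G * (r * suc s * K))) ≡ r * P * ((suc s * F) * (G * K))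
      shuffle₂ = solve-∀

module Cliques where

  open import Data.Bool using (Bool; true; false)
  open import Data.Nat using (ℕ; zero; suc; _+_; _*_; _^_; _!; _≤_; z≤n)
  open import Data.Nat.Properties
  open import Data.List using (List; []; _∷_; length; map; filterᵇ)
  open import Relation.Binary.PropositionalEquality
  open import Algebra.Properties.CommutativeSemigroup *-commutativeSemigroup using (x∙yz≈y∙xz)
  open import Data.Nat.Tactic.RingSolver using (solve-∀)
  open Sums
  open Inequalities

  module Counting {A : Set} (adj : A → A → Bool) where

    N : A → List A → List A
    N u = filterᵇ (adj u)

    cliques : ℕ → List A → ℕ
    cliques zero    V       = 1
    cliques (suc s) []      = 0
    cliques (suc s) (u ∷ V) = cliques (suc s) V + cliques s (N u V)

    cliques-1 : (V : List A) → cliques 1 V ≡ length V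
    cliques-1 []      = refl
    cliques-1 (u ∷ V) = trans (cong (_+ 1) (cliques-1 V)) (+-comm (length V) 1)

    cliques-filterᵇ-≤ : (s : ℕ) (p : A → Bool) (V : List A) → cliques s (filterᵇ p V) ≤ cliques s V
    cliques-filterᵇ-≤ zero    p V       = ≤-refl
    cliques-filterᵇ-≤ (suc s) p []      = ≤-refl
    cliques-filterᵇ-≤ (suc s) p (u ∷ V)
      with p u | cliques-filterᵇ-≤ (suc s) p V | cliques-filterᵇ-≤ s p (N u V)
    ... | true  | ih-V | ih-N =
      +-mono-≤ ih-V (subst (λ W → cliques s W ≤ cliques s (N u V)) (filterᵇ-comm p (adj u) V) ih-N)
    ... | false | ih-V | _    = ≤-trans ih-V (m≤m+n _ _)

    cliques-suc-≡0 : (s : ℕ) (V : List A) → cliques s V ≡ 0 → cliques (suc s) V ≡ 0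
    cliques-suc-≡0 (suc s) []      _  = refl
    cliques-suc-≡0 (suc s) (u ∷ V) ≡0 =
      cong₂ _+_ (cliques-suc-≡0 (suc s) V (m+n≡0⇒m≡0 _ ≡0))
                (cliques-suc-≡0 s (N u V) (m+n≡0⇒n≡0 (cliques (suc s) V) ≡0))

  cliques-map : {A B : Set} (adj : A → A → Bool) (g : B → A) (s : ℕ) (V : List B) →
                Counting.cliques adj s (map g V) ≡ Counting.cliques (λ x y → adj (g x) (g y)) s V
  cliques-map adj g zero    V       = refl
  cliques-map adj g (suc s) []      = refl
  cliques-map adj g (suc s) (u ∷ V) =
    cong₂ _+_ (cliques-map adj g (suc s) V)
              (trans (cong (Counting.cliques adj s) (filterᵇ-map (adj (g u)) g V))
                     (cliques-map adj g s (Counting.N (λ x y → adj (g x) (g y)) u V)))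

  module SimpleGraph {A : Set} (adj : A → A → Bool)
                (adj-sym : ∀ a b → adj a b ≡ adj b a) (adj-irrefl : ∀ a → adj a a ≡ false) where

    open Counting adj public

    N-∷-self : (u : A) (V : List A) → N u (u ∷ V) ≡ N u V
    N-∷-self u V rewrite adj-irrefl u = refl

    cliques-N-∷ : (t : ℕ) (v u : A) (V : List A) →
      cliques (suc t) (N v (u ∷ V)) ≡
      cliques (suc t) (N v V) + when (adj u v) (cliques t (N v (N u V)))
    cliques-N-∷ t v u V rewrite adj-sym u v with adj v u
    ... | true  = cong (cliques (suc t) (N v V) +_)
                       (cong (cliques t) (filterᵇ-comm (adj u) (adj v) V))
    ... | false = sym (+-identityʳ _)

    ∑-cliques-N-∷ : (t : ℕ) (u : A) (V W : List A) →
      ∑ W (λ v → cliques (suc t) (N v (u ∷ V))) ≡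
      ∑ W (λ v → cliques (suc t) (N v V)) + ∑ (N u W) (λ v → cliques t (N v (N u V)))
    ∑-cliques-N-∷ t u V W = begin
        ∑ W (λ v → cliques (suc t) (N v (u ∷ V)))
      ≡⟨ ∑-cong W (λ v → cliques-N-∷ t v u V) ⟩
        ∑ W (λ v → cliques (suc t) (N v V) + when (adj u v) (cliques t (N v (N u V))))
      ≡⟨ ∑-+ W _ _ ⟩
        ∑ W (λ v → cliques (suc t) (N v V)) + ∑ W (λ v → when (adj u v) (cliques t (N v (N u V))))
      ≡⟨ cong (∑ W (λ v → cliques (suc t) (N v V)) +_) (sym (∑-filterᵇ W (adj u) _)) ⟩
        ∑ W (λ v → cliques (suc t) (N v V)) + ∑ (N u W) (λ v → cliques t (N v (N u V)))
      ∎
      where open ≡-Reasoning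

    ∑-cliques-N : (s : ℕ) (V : List A) → ∑ V (λ v → cliques s (N v V)) ≡ suc s * cliques (suc s) V
    ∑-cliques-N zero    V       =
      trans (∑-const V 1) (trans (*-identityʳ _) (sym (trans (+-identityʳ _) (cliques-1 V))))
    ∑-cliques-N (suc t) []      = sym (*-zeroʳ (suc (suc t)))
    ∑-cliques-N (suc t) (u ∷ V) = begin
        cliques (suc t) (N u (u ∷ V)) + ∑ V (λ v → cliques (suc t) (N v (u ∷ V)))
      ≡⟨ cong₂ _+_ (cong (cliques (suc t)) (N-∷-self u V)) (∑-cliques-N-∷ t u V V) ⟩
        Kᵤ + (∑ V (λ v → cliques (suc t) (N v V)) + ∑ (N u V) (λ v → cliques t (N v (N u V))))
      ≡⟨ cong₂ (λ a b → Kᵤ + (a + b)) (∑-cliques-N (suc t) V) (∑-cliques-N t (N u V)) ⟩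
        Kᵤ + (suc (suc t) * cliques (suc (suc t)) V + suc t * Kᵤ)
      ≡⟨ regroup Kᵤ (cliques (suc (suc t)) V) t ⟩
        suc (suc t) * (cliques (suc (suc t)) V + Kᵤ)
      ∎
      where
        open ≡-Reasoning
        Kᵤ = cliques (suc t) (N u V)
        regroup : ∀ a b t → a + (suc (suc t) * b + suc t * a) ≡ suc (suc t) * (b + a)
        regroup = solve-∀

    ∑-filterᵇ-cliques-N-∷ : (t : ℕ) (p : A → Bool) (u : A) (V : List A) →
      ∑ (filterᵇ p V) (λ v → cliques (suc t) (N v (u ∷ V))) ≡
      ∑ (filterᵇ p V) (λ v → cliques (suc t) (N v V)) + ∑ (filterᵇ p (N u V)) (λ v → cliques t (N v (N u V)))
    ∑-filterᵇ-cliques-N-∷ t p u V =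
      trans (∑-cliques-N-∷ t u V (filterᵇ p V))
            (cong (λ W → ∑ (filterᵇ p V) (λ v → cliques (suc t) (N v V)) + ∑ W (λ v → cliques t (N v (N u V))))
                  (filterᵇ-comm (adj u) p V))

    -- A (t+1)-clique is counted once for each of its vertices in p: t+1 times if it lies
    -- inside p, at most t times otherwise.
    ∑-filterᵇ-cliques-N-≤ : (t : ℕ) (p : A → Bool) (V : List A) →
      ∑ (filterᵇ p V) (λ v → cliques t (N v V)) ≤ cliques (suc t) (filterᵇ p V) + t * cliques (suc t) V
    ∑-filterᵇ-cliques-N-≤ zero    p V  = ≤-reflexive (begin-equality
        ∑ (filterᵇ p V) (λ _ → 1)  ≡⟨ ∑-const (filterᵇ p V) 1 ⟩
        length (filterᵇ p V) * 1   ≡⟨ *-identityʳ _ ⟩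
        length (filterᵇ p V)       ≡⟨ sym (cliques-1 (filterᵇ p V)) ⟩
        cliques 1 (filterᵇ p V)    ≡⟨ sym (+-identityʳ _) ⟩
        cliques 1 (filterᵇ p V) + 0 ∎)
      where open ≤-Reasoning
    ∑-filterᵇ-cliques-N-≤ (suc t) p [] = z≤n
    ∑-filterᵇ-cliques-N-≤ (suc t) p (u ∷ V)
      with p u | ∑-filterᵇ-cliques-N-≤ (suc t) p V | ∑-filterᵇ-cliques-N-≤ t p (N u V)
    ... | true | ih-V | ih-N = begin
        cliques (suc t) (N u (u ∷ V)) + ∑ P (λ v → cliques (suc t) (N v (u ∷ V)))
      ≡⟨ cong₂ _+_ (cong (cliques (suc t)) (N-∷-self u V)) (∑-filterᵇ-cliques-N-∷ t p u V) ⟩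
        Kᵤ + (∑ P (λ v → cliques (suc t) (N v V)) + ∑ (filterᵇ p (N u V)) (λ v → cliques t (N v (N u V))))
      ≤⟨ +-monoʳ-≤ Kᵤ (+-mono-≤ ih-V ih-N) ⟩
        Kᵤ + ((cliques (suc (suc t)) P + suc t * K) + (cliques (suc t) (filterᵇ p (N u V)) + t * Kᵤ))
      ≡⟨ regroup Kᵤ (cliques (suc (suc t)) P) K (cliques (suc t) (filterᵇ p (N u V))) t ⟩
        (cliques (suc (suc t)) P + cliques (suc t) (filterᵇ p (N u V))) + suc t * (K + Kᵤ)
      ≡⟨ cong (λ W → (cliques (suc (suc t)) P + cliques (suc t) W) + suc t * (K + Kᵤ)) (filterᵇ-comm p (adj u) V) ⟩
        (cliques (suc (suc t)) P + cliques (suc t) (N u P)) + suc t * (K + Kᵤ)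
      ∎
      where
        open ≤-Reasoning
        P  = filterᵇ p V
        K  = cliques (suc (suc t)) V
        Kᵤ = cliques (suc t) (N u V)
        regroup : ∀ a b c d t → a + ((b + suc t * c) + (d + t * a)) ≡ (b + d) + suc t * (c + a)
        regroup = solve-∀
    ... | false | ih-V | ih-N = begin
        ∑ P (λ v → cliques (suc t) (N v (u ∷ V)))
      ≡⟨ ∑-filterᵇ-cliques-N-∷ t p u V ⟩
        ∑ P (λ v → cliques (suc t) (N v V)) + ∑ (filterᵇ p (N u V)) (λ v → cliques t (N v (N u V)))
      ≤⟨ +-mono-≤ ih-V ih-N ⟩
        (cliques (suc (suc t)) P + suc t * K) + (cliques (suc t) (filterᵇ p (N u V)) + t * Kᵤ)
      ≤⟨ +-monoʳ-≤ (cliques (suc (suc t)) P + suc t * K) (+-monoˡ-≤ (t * Kᵤ) (cliques-filterᵇ-≤ (suc t) p (N u V))) ⟩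
        (cliques (suc (suc t)) P + suc t * K) + (Kᵤ + t * Kᵤ)
      ≡⟨ regroup (cliques (suc (suc t)) P) K Kᵤ t ⟩
        cliques (suc (suc t)) P + suc t * (K + Kᵤ)
      ∎
      where
        open ≤-Reasoning
        P  = filterᵇ p V
        K  = cliques (suc (suc t)) V
        Kᵤ = cliques (suc t) (N u V)
        regroup : ∀ b c a t → (b + suc t * c) + (a + t * a) ≡ b + suc t * (c + a)
        regroup = solve-∀

    ∑-∑-N : (V : List A) (a : A → ℕ) → ∑ V (λ w → ∑ (N w V) a) ≡ ∑ V (λ v → length (N v V) * a v)
    ∑-∑-N V a = begin
        ∑ V (λ w → ∑ (N w V) a)
      ≡⟨ ∑-cong V (λ w → ∑-filterᵇ V (adj w) a) ⟩
        ∑ V (λ w → ∑ V (λ v → when (adj w v) (a v)))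
      ≡⟨ ∑-swap V V (λ w v → when (adj w v) (a v)) ⟩
        ∑ V (λ v → ∑ V (λ w → when (adj w v) (a v)))
      ≡⟨ ∑-cong V (λ v → ∑-cong V (λ w → cong (λ b → when b (a v)) (adj-sym w v))) ⟩
        ∑ V (λ v → ∑ V (λ w → when (adj v w) (a v)))
      ≡⟨ ∑-cong V (λ v → ∑-when-const V (adj v) (a v)) ⟩
        ∑ V (λ v → length (N v V) * a v)
      ∎
      where open ≡-Reasoning

    ∑-degree-cliques-N-≤ : (j : ℕ) (V : List A) →
      ∑ V (λ v → length (N v V) * cliques (suc j) (N v V)) ≤
      suc (suc (suc j)) * cliques (suc (suc (suc j))) V + suc j * (length V * cliques (suc (suc j)) V)
    ∑-degree-cliques-N-≤ j V = begin
        ∑ V (λ v → length (N v V) * cliques (suc j) (N v V))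
      ≡⟨ sym (∑-∑-N V (λ v → cliques (suc j) (N v V))) ⟩
        ∑ V (λ w → ∑ (N w V) (λ v → cliques (suc j) (N v V)))
      ≤⟨ ∑-mono-≤ V (λ w → ∑-filterᵇ-cliques-N-≤ (suc j) (adj w) V) ⟩
        ∑ V (λ w → cliques (suc (suc j)) (N w V) + suc j * cliques (suc (suc j)) V)
      ≡⟨ ∑-+ V _ _ ⟩
        ∑ V (λ w → cliques (suc (suc j)) (N w V)) + ∑ V (λ _ → suc j * cliques (suc (suc j)) V)
      ≡⟨ cong₂ _+_ (∑-cliques-N (suc (suc j)) V) (∑-const V _) ⟩
        suc (suc (suc j)) * cliques (suc (suc (suc j))) V + length V * (suc j * cliques (suc (suc j)) V)
      ≡⟨ cong (suc (suc (suc j)) * cliques (suc (suc (suc j))) V +_) (x∙yz≈y∙xz (length V) (suc j) _) ⟩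
        suc (suc (suc j)) * cliques (suc (suc (suc j))) V + suc j * (length V * cliques (suc (suc j)) V)
      ∎
      where open ≤-Reasoning

    -- The inequality for j inside every neighbourhood N v, summed over v by Cauchy–Schwarz.
    moon-moser : (j : ℕ) (V : List A) →
      suc j * suc j * (cliques (suc j) V * cliques (suc j) V) ≤
      j * suc (suc j) * (cliques (suc (suc j)) V * cliques j V) + length V * (cliques (suc j) V * cliques j V)
    moon-moser zero V rewrite cliques-1 V = ≤-reflexive (base (length V))
      where
        base : ∀ n → 1 * 1 * (n * n) ≡ 0 + n * (n * 1)
        base = solve-∀
    moon-moser (suc j) V = *-cancelˡ-≤ (suc j * suc j) (begin
        suc j * suc j * (suc (suc j) * suc (suc j) * (K₂ * K₂))
      ≡⟨ trans (square-scale j K₂) (cong (λ z → suc j * suc j * (z * z)) (sym (∑-cliques-N (suc j) V))) ⟩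
        suc j * suc j * (∑ V a * ∑ V a)
      ≤⟨ ∑-cauchy-schwarz V (suc j * suc j) a b y local ⟩
        ∑ V b * ∑ V y
      ≡⟨ cong (∑ V b *_) ∑y ⟩
        ∑ V b * (j * suc (suc j) * (suc (suc (suc j)) * K₃) + ∑ V (λ v → length (N v V) * a v))
      ≤⟨ *-monoʳ-≤ (∑ V b) (+-monoʳ-≤ _ (∑-degree-cliques-N-≤ j V)) ⟩
        ∑ V b * (j * suc (suc j) * (suc (suc (suc j)) * K₃) + (suc (suc (suc j)) * K₃ + suc j * (n * K₂)))
      ≡⟨ cong (_* (j * suc (suc j) * (suc (suc (suc j)) * K₃) + (suc (suc (suc j)) * K₃ + suc j * (n * K₂))))
              (∑-cliques-N j V) ⟩
        suc j * K₁ * (j * suc (suc j) * (suc (suc (suc j)) * K₃) + (suc (suc (suc j)) * K₃ + suc j * (n * K₂)))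
      ≡⟨ collect j K₁ K₂ K₃ n ⟩
        suc j * suc j * (suc j * suc (suc (suc j)) * (K₃ * K₁) + n * (K₂ * K₁))
      ∎)
      where
        open ≤-Reasoning
        n  = length V
        K₁ = cliques (suc j) V
        K₂ = cliques (suc (suc j)) V
        K₃ = cliques (suc (suc (suc j))) V
        a b y : A → ℕ
        a v = cliques (suc j) (N v V)
        b v = cliques j (N v V)
        y v = j * suc (suc j) * cliques (suc (suc j)) (N v V) + length (N v V) * a v
        local : ∀ v → suc j * suc j * (a v * a v) ≤ b v * y v
        local v = ≤-trans (moon-moser j (N v V)) (≤-reflexive (factor j (cliques (suc (suc j)) (N v V)) (a v) (b v) (length (N v V))))
          where
            factor : ∀ j x y z d → j * suc (suc j) * (x * z) + d * (y * z) ≡ z * (j * suc (suc j) * x + d * y)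
            factor = solve-∀
        ∑y : ∑ V y ≡ j * suc (suc j) * (suc (suc (suc j)) * K₃) + ∑ V (λ v → length (N v V) * a v)
        ∑y = trans (∑-+ V _ _)
                   (cong (_+ ∑ V (λ v → length (N v V) * a v))
                         (trans (∑-*ˡ V (j * suc (suc j)) (λ v → cliques (suc (suc j)) (N v V)))
                                (cong (j * suc (suc j) *_) (∑-cliques-N (suc (suc j)) V))))
        square-scale : ∀ j K → suc j * suc j * (suc (suc j) * suc (suc j) * (K * K)) ≡
                               suc j * suc j * ((suc (suc j) * K) * (suc (suc j) * K))
        square-scale = solve-∀
        collect : ∀ j K₁ K₂ K₃ n →
          suc j * K₁ * (j * suc (suc j) * (suc (suc (suc j)) * K₃) + (suc (suc (suc j)) * K₃ + suc j * (n * K₂))) ≡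
          suc j * suc j * (suc j * suc (suc (suc j)) * (K₃ * K₁) + n * (K₂ * K₁))
        collect = solve-∀

    edge-clique-inequality : (V : List A) (j : ℕ) →
      2 * suc j * (cliques 2 V * cliques (suc j) V) ≤
      suc (suc j) * (length V * cliques (suc (suc j)) V) + j * (length V * length V * cliques (suc j) V)
    edge-clique-inequality V zero rewrite cliques-1 V = ≤-reflexive (base (cliques 2 V) (length V))
      where
        base : ∀ E n → 2 * 1 * (E * n) ≡ 2 * (n * E) + 0 * (n * n * n)
        base = solve-∀
    edge-clique-inequality V (suc j) =
      edge-clique-step j (length V) (cliques 2 V) (cliques (suc j) V) (cliques (suc (suc j)) V)
        (cliques (suc (suc (suc j))) V) (edge-clique-inequality V j) (moon-moser (suc j) V)
        (cliques-suc-≡0 (suc j) V)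

    power-≤-cliques : (V : List A) (r : ℕ) → r * (length V * length V) ≤ 2 * suc r * cliques 2 V →
      length V ^ suc r ≤ suc r ^ suc r * cliques (suc r) V
    power-≤-cliques V r density =
      *-cancelʳ-≤ _ _ (suc r !) {{suc r !≢0}}
        (subst (n ^ suc r * suc r ! ≤_) (reorder (suc r ^ suc r) (suc r !) (cliques (suc r) V))
          (clique-ratio-product (λ s → cliques s V) (suc r) n refl ratio (suc r) 0 (+-identityʳ _)))
      where
        n = length V
        reorder : ∀ P F K → P * (F * (1 * K)) ≡ P * K * F
        reorder = solve-∀
        ratio : ∀ s m → suc s + m ≡ suc r → suc m * (n * cliques s V) ≤ suc r * suc s * cliques (suc s) V
        ratio zero m refl rewrite cliques-1 V = ≤-reflexive (reorder₁ (suc m) n)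
          where
            reorder₁ : ∀ a n → a * (n * 1) ≡ a * 1 * n
            reorder₁ = solve-∀
        ratio (suc j) m s+m≡r =
          subst (λ R → suc m * (n * cliques (suc j) V) ≤ R * suc (suc j) * cliques (suc (suc j)) V) s+m≡r
            (clique-ratio j m n (cliques 2 V) (cliques (suc j) V) (cliques (suc (suc j)) V)
              (subst (λ R → R * (n * n) ≤ 2 * suc R * cliques 2 V) (sym (suc-injective s+m≡r)) density)
              (edge-clique-inequality V j))

    excess-≤-cliques : (V : List A) (r D : ℕ) → 2 * suc r * cliques 2 V ≡ r * (length V * length V) + D →
      D * cliques (suc r) V ≤ suc (suc r) * (length V * cliques (suc (suc r)) V)
    excess-≤-cliques V r D edges = +-cancelʳ-≤ (r * (n * n * K)) _ _ (begin
        D * K + r * (n * n * K)         ≡⟨ distrib D r (n * n) K ⟩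
        (r * (n * n) + D) * K           ≡⟨ cong (_* K) (sym edges) ⟩
        2 * suc r * cliques 2 V * K     ≡⟨ *-assoc (2 * suc r) (cliques 2 V) K ⟩
        2 * suc r * (cliques 2 V * K)   ≤⟨ edge-clique-inequality V r ⟩
        suc (suc r) * (n * cliques (suc (suc r)) V) + r * (n * n * K) ∎)
      where
        open ≤-Reasoning
        n = length V
        K = cliques (suc r) V
        distrib : ∀ D r m K → D * K + r * (m * K) ≡ (r * m + D) * K
        distrib = solve-∀

module SubsetCliques where

  open import Defs hiding (sym)
  open import Data.Bool using (Bool; true; false; _∧_; _∨_; not)
  open import Data.Bool.Properties
    using (∧-assoc; ∧-conicalˡ; ∧-conicalʳ; ∧-identityʳ; ∧-zeroʳ; ∧-idem; ∨-zeroʳ; ∨-distribˡ-∧)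
  open import Data.Bool.ListAction using (and; all)
  open import Data.Nat using (ℕ; zero; suc; _+_; _≡ᵇ_)
  open import Data.Nat.Properties using (*-zeroʳ; +-comm; +-identityʳ)
  open import Data.Nat.Tactic.RingSolver using (solve-∀)
  open import Data.Fin using (Fin; _≟_) renaming (zero to fzero; suc to fsuc)
  open import Data.Fin.Subset using (Subset; ∣_∣)
  open import Data.Vec using ([]; _∷_; lookup)
  open import Data.List using (List; []; _∷_; _++_; length; map; filterᵇ; concatMap; allFin; tabulate)
  open import Data.List.Properties using (map-++; map-cong; map-∘; map-tabulate)
  open import Data.Product using (_,_)
  open import Function using (id; _∘_)
  open import Relation.Nullary using (yes; no)
  open import Relation.Nullary.Decidable using (⌊_⌋)
  open import Relation.Binary.PropositionalEquality
  open import Data.Bool.Solver using (module ∨-∧-Solver)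
  open Sums
  open Cliques using (module Counting; cliques-map)
  open Counting using (N; cliques)

  all-allFin-suc : ∀ {n} (h : Fin (suc n) → Bool) →
                   all h (allFin (suc n)) ≡ h fzero ∧ all (h ∘ fsuc) (allFin n)
  all-allFin-suc {n} h =
    cong (λ L → h fzero ∧ and L) (trans (map-tabulate fsuc h) (sym (map-tabulate id (h ∘ fsuc))))

  all-cong : ∀ {A : Set} {h h′ : A → Bool} → (∀ i → h i ≡ h′ i) → ∀ xs → all h xs ≡ all h′ xs
  all-cong h≗h′ xs = cong and (map-cong h≗h′ xs)

  all-const-true : ∀ {A : Set} (xs : List A) → all (λ _ → true) xs ≡ true
  all-const-true []       = refl
  all-const-true (x ∷ xs) = all-const-true xs

  all-∧ : ∀ {A : Set} (h h′ : A → Bool) xs → all (λ i → h i ∧ h′ i) xs ≡ all h xs ∧ all h′ xs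
  all-∧ h h′ []       = refl
  all-∧ h h′ (x ∷ xs) = trans (cong ((h x ∧ h′ x) ∧_) (all-∧ h h′ xs)) (interchange (h x) (h′ x) _ _)
    where open ∨-∧-Solver
          interchange : ∀ a b c d → (a ∧ b) ∧ (c ∧ d) ≡ (a ∧ c) ∧ (b ∧ d)
          interchange = solve 4 (λ a b c d → (a :* b) :* (c :* d) := (a :* c) :* (b :* d)) refl

  all-allFin-true : ∀ {n} (h : Fin n → Bool) → all h (allFin n) ≡ true → ∀ i → h i ≡ true
  all-allFin-true h ≡true fzero    = ∧-conicalˡ _ _ (trans (sym (all-allFin-suc h)) ≡true)
  all-allFin-true h ≡true (fsuc i) =
    all-allFin-true (h ∘ fsuc) (∧-conicalʳ _ _ (trans (sym (all-allFin-suc h)) ≡true)) i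

  and-++ : (xs ys : List Bool) → and (xs ++ ys) ≡ and xs ∧ and ys
  and-++ []       ys = refl
  and-++ (x ∷ xs) ys = trans (cong (x ∧_) (and-++ xs ys)) (sym (∧-assoc x (and xs) (and ys)))

  all-concatMap : ∀ {X Y : Set} (f : X → Bool) (g : Y → List X) (L : List Y) →
                  all f (concatMap g L) ≡ all (λ y → all f (g y)) L
  all-concatMap f g []      = refl
  all-concatMap f g (y ∷ L) =
    trans (cong and (map-++ f (g y) (concatMap g L)))
          (trans (and-++ (map f (g y)) _) (cong (all f (g y) ∧_) (all-concatMap f g L)))

  _⊆ᵇ_ : ∀ {n} → Subset n → (Fin n → Bool) → Bool
  _⊆ᵇ_ {n} p W = all (λ i → not (lookup p i) ∨ W i) (allFin n)

  cliquePair : ∀ {n} → Graph n → Subset n → Fin n → Fin n → Bool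
  cliquePair G p i j = not (lookup p i ∧ lookup p j ∧ not ⌊ i ≟ j ⌋) ∨ adj G i j

  isCliqueᵇ-all : ∀ {n} (G : Graph n) (p : Subset n) →
                  isCliqueᵇ G p ≡ all (λ i → all (cliquePair G p i) (allFin n)) (allFin n)
  isCliqueᵇ-all {n} G p =
    trans (all-concatMap _ (λ i → map (λ j → (i , j)) (allFin n)) (allFin n))
          (cong and (map-cong (λ i → cong and (sym (map-∘ (allFin n)))) (allFin n)))

  tailGraph : ∀ {n} → Graph (suc n) → Graph n
  tailGraph G = record
    { adj    = λ i j → adj G (fsuc i) (fsuc j)
    ; sym    = λ i j → Graph.sym G (fsuc i) (fsuc j)
    ; irrefl = λ i → irrefl G (fsuc i)
    }

  ≟-fsuc : ∀ {n} (i j : Fin n) → ⌊ fsuc i ≟ fsuc j ⌋ ≡ ⌊ i ≟ j ⌋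
  ≟-fsuc i j with i ≟ j
  ... | yes _ = refl
  ... | no  _ = refl

  N₀ : ∀ {n} → Graph (suc n) → Fin n → Bool
  N₀ G j = adj G fzero (fsuc j)

  module _ {n : ℕ} (G : Graph (suc n)) where

    isCliqueᵇ-∷ : (b : Bool) (q : Subset n) →
                  isCliqueᵇ G (b ∷ q) ≡ (not b ∨ q ⊆ᵇ N₀ G) ∧ isCliqueᵇ (tailGraph G) q
    isCliqueᵇ-∷ b q = begin
        isCliqueᵇ G (b ∷ q)
      ≡⟨ isCliqueᵇ-all G (b ∷ q) ⟩
        all (λ i → all (F i) (allFin (suc n))) (allFin (suc n))
      ≡⟨ all-allFin-suc (λ i → all (F i) (allFin (suc n))) ⟩
        all (F fzero) (allFin (suc n)) ∧ all (λ i → all (F (fsuc i)) (allFin (suc n))) (allFin n)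
      ≡⟨ cong₂ _∧_ (all-allFin-suc (F fzero)) (all-cong (λ i → all-allFin-suc (F (fsuc i))) (allFin n)) ⟩
        (F fzero fzero ∧ all (F fzero ∘ fsuc) (allFin n)) ∧
          all (λ i → F (fsuc i) fzero ∧ all (F (fsuc i) ∘ fsuc) (allFin n)) (allFin n)
      ≡⟨ cong ((F fzero fzero ∧ all (F fzero ∘ fsuc) (allFin n)) ∧_) (all-∧ _ _ (allFin n)) ⟩
        (F fzero fzero ∧ all (F fzero ∘ fsuc) (allFin n)) ∧
          (all (λ i → F (fsuc i) fzero) (allFin n) ∧ all (λ i → all (F (fsuc i) ∘ fsuc) (allFin n)) (allFin n))
      ≡⟨ cong (λ x → (F fzero fzero ∧ all (F fzero ∘ fsuc) (allFin n)) ∧ (all (λ i → F (fsuc i) fzero) (allFin n) ∧ x))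
              (trans (all-cong (λ i → all-cong (λ j → tail-pair i j) (allFin n)) (allFin n))
                     (sym (isCliqueᵇ-all (tailGraph G) q))) ⟩
        (F fzero fzero ∧ all (F fzero ∘ fsuc) (allFin n)) ∧
          (all (λ i → F (fsuc i) fzero) (allFin n) ∧ isCliqueᵇ (tailGraph G) q)
      ≡⟨ head-pairs b ⟩
        (not b ∨ q ⊆ᵇ N₀ G) ∧ isCliqueᵇ (tailGraph G) q
      ∎
      where
        open ≡-Reasoning
        F = cliquePair G (b ∷ q)
        C = isCliqueᵇ (tailGraph G) q
        tail-pair : ∀ i j → F (fsuc i) (fsuc j) ≡ cliquePair (tailGraph G) q i j
        tail-pair i j = cong (λ z → not (lookup q i ∧ lookup q j ∧ not z) ∨ adj G (fsuc i) (fsuc j)) (≟-fsuc i j)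
        head-pairs : ∀ b → (cliquePair G (b ∷ q) fzero fzero ∧ all (cliquePair G (b ∷ q) fzero ∘ fsuc) (allFin n)) ∧
                           (all (λ i → cliquePair G (b ∷ q) (fsuc i) fzero) (allFin n) ∧ C) ≡
                           (not b ∨ q ⊆ᵇ N₀ G) ∧ C
        head-pairs true = trans
          (cong₂ (λ x y → x ∧ (y ∧ C))
            (all-cong (λ j → cong (λ z → not z ∨ N₀ G j) (∧-identityʳ (lookup q j))) (allFin n))
            (all-cong (λ i → cong₂ (λ z w → not z ∨ w) (∧-identityʳ (lookup q i)) (Graph.sym G (fsuc i) fzero)) (allFin n)))
          (trans (sym (∧-assoc (q ⊆ᵇ N₀ G) _ C)) (cong (_∧ C) (∧-idem (q ⊆ᵇ N₀ G))))
        head-pairs false = cong₂ (λ x y → x ∧ (y ∧ C))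
          (all-const-true (allFin n))
          (trans (all-cong (λ i → cong (λ z → not z ∨ adj G (fsuc i) fzero) (∧-zeroʳ (lookup q i))) (allFin n))
                 (all-const-true (allFin n)))

  countᵇ-cong : ∀ {X : Set} (L : List X) {p q : X → Bool} → (∀ x → p x ≡ q x) → countᵇ p L ≡ countᵇ q L
  countᵇ-cong L p≗q = ∑-cong L (λ x → cong (λ b → when b 1) (p≗q x))

  countᵇ-∧ : ∀ {X : Set} (w : Bool) (p : X → Bool) (L : List X) → countᵇ (λ x → w ∧ p x) L ≡ when w (countᵇ p L)
  countᵇ-∧ true  p L = refl
  countᵇ-∧ false p L = trans (∑-const L 0) (*-zeroʳ (length L))

  countᵇ-allSubsets-suc : ∀ {n} (p : Subset (suc n) → Bool) →
    countᵇ p (allSubsets (suc n)) ≡ countᵇ (λ q → p (true ∷ q)) (allSubsets n) + countᵇ (λ q → p (false ∷ q)) (allSubsets n)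
  countᵇ-allSubsets-suc {n} p = go (allSubsets n)
    where
      go : (L : List (Subset n)) →
        countᵇ p (concatMap (λ s → (true ∷ s) ∷ (false ∷ s) ∷ []) L) ≡
        countᵇ (λ q → p (true ∷ q)) L + countᵇ (λ q → p (false ∷ q)) L
      go []      = refl
      go (q ∷ L) = trans (cong (λ z → when (p (true ∷ q)) 1 + (when (p (false ∷ q)) 1 + z)) (go L))
                         (shuffle (when (p (true ∷ q)) 1) (when (p (false ∷ q)) 1) _ _)
        where
          shuffle : ∀ a b c d → a + (b + (c + d)) ≡ (a + c) + (b + d)
          shuffle = solve-∀

  isCliqueWithinᵇ : ∀ {n} → Graph n → ℕ → (Fin n → Bool) → Subset n → Bool
  isCliqueWithinᵇ G s W p = (∣ p ∣ ≡ᵇ s) ∧ (isCliqueᵇ G p ∧ p ⊆ᵇ W)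

  cliquesWithin : ∀ {n} → Graph n → ℕ → (Fin n → Bool) → ℕ
  cliquesWithin {n} G s W = countᵇ (isCliqueWithinᵇ G s W) (allSubsets n)

  module _ {m : ℕ} (G : Graph (suc m)) (W : Fin (suc m) → Bool) where

    private
      G′ = tailGraph G
      S = allSubsets m
      W∩N₀ : Fin m → Bool
      W∩N₀ i = W (fsuc i) ∧ N₀ G i

    isCliqueWithinᵇ-false∷ : ∀ s q → isCliqueWithinᵇ G s W (false ∷ q) ≡ isCliqueWithinᵇ G′ s (W ∘ fsuc) q
    isCliqueWithinᵇ-false∷ s q =
      cong₂ (λ x y → (∣ q ∣ ≡ᵇ s) ∧ (x ∧ y)) (isCliqueᵇ-∷ G false q)
            (all-allFin-suc (λ i → not (lookup (false ∷ q) i) ∨ W i))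

    isCliqueWithinᵇ-true∷ : ∀ s q → isCliqueWithinᵇ G (suc s) W (true ∷ q) ≡ W fzero ∧ isCliqueWithinᵇ G′ s W∩N₀ q
    isCliqueWithinᵇ-true∷ s q = begin
        (∣ q ∣ ≡ᵇ s) ∧ (isCliqueᵇ G (true ∷ q) ∧ (true ∷ q) ⊆ᵇ W)
      ≡⟨ cong₂ (λ x y → (∣ q ∣ ≡ᵇ s) ∧ (x ∧ y)) (isCliqueᵇ-∷ G true q)
               (all-allFin-suc (λ i → not (lookup (true ∷ q) i) ∨ W i)) ⟩
        (∣ q ∣ ≡ᵇ s) ∧ ((q ⊆ᵇ N₀ G ∧ isCliqueᵇ G′ q) ∧ (W fzero ∧ q ⊆ᵇ (W ∘ fsuc)))
      ≡⟨ reorder (∣ q ∣ ≡ᵇ s) (q ⊆ᵇ N₀ G) (isCliqueᵇ G′ q) (W fzero) (q ⊆ᵇ (W ∘ fsuc)) ⟩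
        W fzero ∧ ((∣ q ∣ ≡ᵇ s) ∧ (isCliqueᵇ G′ q ∧ (q ⊆ᵇ (W ∘ fsuc) ∧ q ⊆ᵇ N₀ G)))
      ≡⟨ cong (λ x → W fzero ∧ ((∣ q ∣ ≡ᵇ s) ∧ (isCliqueᵇ G′ q ∧ x)))
              (sym (trans (all-cong (λ i → ∨-distribˡ-∧ (not (lookup q i)) (W (fsuc i)) (N₀ G i)) (allFin m))
                          (all-∧ _ _ (allFin m)))) ⟩
        W fzero ∧ isCliqueWithinᵇ G′ s W∩N₀ q
      ∎
      where
        open ≡-Reasoning
        open ∨-∧-Solver
        reorder : ∀ e z c w x → e ∧ ((z ∧ c) ∧ (w ∧ x)) ≡ w ∧ (e ∧ (c ∧ (x ∧ z)))
        reorder = solve 5 (λ e z c w x → e :* ((z :* c) :* (w :* x)) := w :* (e :* (c :* (x :* z)))) refl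

    cliquesWithin-zero : cliquesWithin G 0 W ≡ cliquesWithin G′ 0 (W ∘ fsuc)
    cliquesWithin-zero = begin
        cliquesWithin G 0 W
      ≡⟨ countᵇ-allSubsets-suc (isCliqueWithinᵇ G 0 W) ⟩
        countᵇ (λ q → isCliqueWithinᵇ G 0 W (true ∷ q)) S + countᵇ (λ q → isCliqueWithinᵇ G 0 W (false ∷ q)) S
      ≡⟨ cong₂ _+_ (trans (∑-const S 0) (*-zeroʳ (length S))) (countᵇ-cong S (isCliqueWithinᵇ-false∷ 0)) ⟩
        cliquesWithin G′ 0 (W ∘ fsuc)
      ∎
      where open ≡-Reasoning

    cliquesWithin-suc : ∀ s →
      cliquesWithin G (suc s) W ≡ cliquesWithin G′ (suc s) (W ∘ fsuc) + when (W fzero) (cliquesWithin G′ s W∩N₀)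
    cliquesWithin-suc s = begin
        cliquesWithin G (suc s) W
      ≡⟨ countᵇ-allSubsets-suc (isCliqueWithinᵇ G (suc s) W) ⟩
        countᵇ (λ q → isCliqueWithinᵇ G (suc s) W (true ∷ q)) S + countᵇ (λ q → isCliqueWithinᵇ G (suc s) W (false ∷ q)) S
      ≡⟨ cong₂ _+_ (trans (countᵇ-cong S (isCliqueWithinᵇ-true∷ s)) (countᵇ-∧ (W fzero) _ S))
                   (countᵇ-cong S (isCliqueWithinᵇ-false∷ (suc s))) ⟩
        when (W fzero) (cliquesWithin G′ s W∩N₀) + cliquesWithin G′ (suc s) (W ∘ fsuc)
      ≡⟨ +-comm (when (W fzero) (cliquesWithin G′ s W∩N₀)) _ ⟩
        cliquesWithin G′ (suc s) (W ∘ fsuc) + when (W fzero) (cliquesWithin G′ s W∩N₀)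
      ∎
      where open ≡-Reasoning

    private
      Y = filterᵇ (W ∘ fsuc) (allFin m)

      cliques-map-fsuc : ∀ t (V : List (Fin m)) → cliques (adj G) t (map fsuc V) ≡ cliques (adj G′) t V
      cliques-map-fsuc = cliques-map (adj G) fsuc

      filterᵇ-tabulate-fsuc : filterᵇ W (tabulate fsuc) ≡ map fsuc Y
      filterᵇ-tabulate-fsuc = trans (cong (filterᵇ W) (sym (map-tabulate id fsuc))) (filterᵇ-map W fsuc (allFin m))

      N-fzero : N (adj G) fzero (map fsuc Y) ≡ map fsuc (filterᵇ W∩N₀ (allFin m))
      N-fzero = trans (filterᵇ-map (adj G fzero) fsuc Y) (cong (map fsuc) (filterᵇ-∧ (N₀ G) (W ∘ fsuc) (allFin m)))

    cliques-filterᵇ-allFin-suc : ∀ s →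
      cliques (adj G) (suc s) (filterᵇ W (allFin (suc m))) ≡
      cliques (adj G′) (suc s) Y + when (W fzero) (cliques (adj G′) s (filterᵇ W∩N₀ (allFin m)))
    cliques-filterᵇ-allFin-suc s with W fzero
    ... | false = trans (cong (cliques (adj G) (suc s)) filterᵇ-tabulate-fsuc)
                        (trans (cliques-map-fsuc (suc s) Y) (sym (+-identityʳ _)))
    ... | true  = cong₂ _+_
      (trans (cong (cliques (adj G) (suc s)) filterᵇ-tabulate-fsuc) (cliques-map-fsuc (suc s) Y))
      (trans (cong (λ V → cliques (adj G) s (N (adj G) fzero V)) filterᵇ-tabulate-fsuc)
             (trans (cong (cliques (adj G) s) N-fzero) (cliques-map-fsuc s _)))

  cliquesWithin≡cliques : ∀ {n} (G : Graph n) s W → cliquesWithin G s W ≡ cliques (adj G) s (filterᵇ W (allFin n))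
  cliquesWithin≡cliques {zero}  G zero    W = refl
  cliquesWithin≡cliques {zero}  G (suc s) W = refl
  cliquesWithin≡cliques {suc m} G zero    W =
    trans (cliquesWithin-zero G W) (cliquesWithin≡cliques (tailGraph G) zero (W ∘ fsuc))
  cliquesWithin≡cliques {suc m} G (suc s) W =
    trans (cliquesWithin-suc G W s)
          (trans (cong₂ _+_ (cliquesWithin≡cliques (tailGraph G) (suc s) (W ∘ fsuc))
                            (cong (when (W fzero)) (cliquesWithin≡cliques (tailGraph G) s _)))
                 (sym (cliques-filterᵇ-allFin-suc G W s)))

  k≡cliques : ∀ {n} s (G : Graph n) → k s G ≡ cliques (adj G) s (allFin n)
  k≡cliques {n} s G = begin
      k s G
    ≡⟨ countᵇ-cong (allSubsets n) (λ p → cong ((∣ p ∣ ≡ᵇ s) ∧_) (sym (within-everything p))) ⟩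
      cliquesWithin G s (λ _ → true)
    ≡⟨ cliquesWithin≡cliques G s (λ _ → true) ⟩
      cliques (adj G) s (filterᵇ (λ _ → true) (allFin n))
    ≡⟨ cong (cliques (adj G) s) (filterᵇ-const-true (allFin n)) ⟩
      cliques (adj G) s (allFin n)
    ∎
    where
      open ≡-Reasoning
      within-everything : ∀ p → isCliqueᵇ G p ∧ p ⊆ᵇ (λ _ → true) ≡ isCliqueᵇ G p
      within-everything p =
        trans (cong (isCliqueᵇ G p ∧_) (trans (all-cong (λ i → ∨-zeroʳ (not (lookup p i))) (allFin n)) (all-const-true (allFin n))))
              (∧-identityʳ _)
      filterᵇ-const-true : ∀ {X : Set} (L : List X) → filterᵇ (λ _ → true) L ≡ L
      filterᵇ-const-true []      = refl
      filterᵇ-const-true (x ∷ L) = cong (x ∷_) (filterᵇ-const-true L)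

module Edges where

  open import Defs hiding (sym)
  open import Data.Bool using (true; false; _∧_; T)
  open import Data.Nat using (ℕ; _+_; _*_; _≤_; z≤n; _<ᵇ_)
  open import Data.Nat.Properties
  open import Data.Fin using (Fin; toℕ)
  open import Data.Fin.Properties using (toℕ-injective)
  open import Data.List using (List; []; _∷_; map; concatMap; allFin; length)
  open import Data.List.Properties using (length-tabulate)
  open import Function using (id)
  open import Data.Product using (_×_; _,_)
  open import Relation.Binary.PropositionalEquality
  open import Relation.Nullary.Negation using (contradiction)
  open Sums
  open Cliques

  ∑-pairs : ∀ {X : Set} (L : List X) (f : X × X → ℕ) →
    ∑ (concatMap (λ i → map (λ j → (i , j)) L) L) f ≡ ∑ L (λ i → ∑ L (λ j → f (i , j)))
  ∑-pairs L f = go L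
    where
      go : ∀ L′ → ∑ (concatMap (λ i → map (λ j → (i , j)) L) L′) f ≡ ∑ L′ (λ i → ∑ L (λ j → f (i , j)))
      go []       = refl
      go (i ∷ L′) = trans (∑-++ (map (λ j → (i , j)) L) _ f) (cong₂ _+_ (∑-map L (λ j → (i , j)) f) (go L′))

  module _ {n : ℕ} (G : Graph n) where

    open SimpleGraph (adj G) (Graph.sym G) (irrefl G)

    private
      V = allFin n

      forward : Fin n → Fin n → ℕ
      forward i j = when ((toℕ i <ᵇ toℕ j) ∧ adj G i j) 1

      forward-+-backward : ∀ i j → forward i j + forward j i ≡ when (adj G i j) 1
      forward-+-backward i j with toℕ i <ᵇ toℕ j in i<j | toℕ j <ᵇ toℕ i in j<i
      ... | true  | true  = contradiction (<ᵇ⇒< (toℕ j) (toℕ i) (subst T (sym j<i) _))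
                                          (<-asym (<ᵇ⇒< (toℕ i) (toℕ j) (subst T (sym i<j) _)))
      ... | true  | false = +-identityʳ _
      ... | false | true  = cong (λ b → when b 1) (Graph.sym G j i)
      ... | false | false = cong (λ b → when b 1) (sym (trans (cong (adj G i) (sym i≡j)) (irrefl G i)))
        where
          i≡j : i ≡ j
          i≡j = toℕ-injective (≤-antisym (≮⇒≥ (λ j<i′ → subst T j<i (<⇒<ᵇ j<i′)))
                                         (≮⇒≥ (λ i<j′ → subst T i<j (<⇒<ᵇ i<j′))))

    ∑-degrees : ∑ V (λ i → ∑ V (λ j → when (adj G i j) 1)) ≡ 2 * cliques 2 V
    ∑-degrees = begin
        ∑ V (λ i → ∑ V (λ j → when (adj G i j) 1))
      ≡⟨ ∑-cong V (λ i → trans (∑-when-const V (adj G i) 1) (trans (*-identityʳ _) (sym (cliques-1 (N i V))))) ⟩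
        ∑ V (λ i → cliques 1 (N i V))
      ≡⟨ ∑-cliques-N 1 V ⟩
        2 * cliques 2 V
      ∎
      where open ≡-Reasoning

    e+e : e G + e G ≡ ∑ V (λ i → ∑ V (λ j → when (adj G i j) 1))
    e+e = begin
        e G + e G
      ≡⟨ cong₂ _+_ e≡∑∑ (trans e≡∑∑ (∑-swap V V forward)) ⟩
        ∑ V (λ i → ∑ V (λ j → forward i j)) + ∑ V (λ i → ∑ V (λ j → forward j i))
      ≡⟨ sym (∑-+ V _ _) ⟩
        ∑ V (λ i → ∑ V (λ j → forward i j) + ∑ V (λ j → forward j i))
      ≡⟨ ∑-cong V (λ i → trans (sym (∑-+ V _ _)) (∑-cong V (forward-+-backward i))) ⟩
        ∑ V (λ i → ∑ V (λ j → when (adj G i j) 1))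
      ∎
      where
        open ≡-Reasoning
        e≡∑∑ : e G ≡ ∑ V (λ i → ∑ V (λ j → forward i j))
        e≡∑∑ = ∑-pairs V _

    e≡cliques-2 : e G ≡ cliques 2 V
    e≡cliques-2 = *-cancelˡ-≡ (e G) (cliques 2 V) 2 (trans (cong (e G +_) (+-identityʳ (e G))) (trans e+e ∑-degrees))

    ∑-adjacent-pairs : ∑ (allPairs n) (λ { (u , v) → when (adj G u v) 1 }) ≡ 2 * e G
    ∑-adjacent-pairs = trans (∑-pairs V _) (trans ∑-degrees (cong (2 *_) (sym e≡cliques-2)))

    2*e≤n² : 2 * e G ≤ n * n
    2*e≤n² = begin
        2 * e G
      ≡⟨ trans (cong (2 *_) e≡cliques-2) (sym ∑-degrees) ⟩
        ∑ V (λ i → ∑ V (λ j → when (adj G i j) 1))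
      ≤⟨ ∑-mono-≤ V (λ i → ∑-mono-≤ V (λ j → when-≤ (adj G i j))) ⟩
        ∑ V (λ i → ∑ V (λ j → 1))
      ≡⟨ trans (∑-cong V (λ i → trans (∑-const V 1) (*-identityʳ _))) (∑-const V (length V)) ⟩
        length V * length V
      ≡⟨ cong₂ _*_ (length-tabulate {n = n} id) (length-tabulate {n = n} id) ⟩
        n * n
      ∎
      where
        open ≤-Reasoning
        when-≤ : ∀ b → when b 1 ≤ 1
        when-≤ true  = ≤-refl
        when-≤ false = z≤n

module Jointsize where

  open import Defs hiding (sym)
  open import Data.Bool using (Bool; true; false; _∧_; _∨_; not; T; if_then_else_)
  open import Data.Bool.Properties using (∧-idem)
  open import Data.Nat using (ℕ; zero; suc; _+_; _*_; _≤_; z≤n; _≡ᵇ_)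
  open import Data.Nat.Properties hiding (_≟_)
  open import Data.Fin using (Fin; _≟_) renaming (zero to fzero; suc to fsuc)
  open import Data.Fin.Subset using (Subset; ∣_∣)
  open import Data.Vec using ([]; _∷_; lookup)
  open import Data.List using (List; []; _∷_; allFin; length)
  open import Data.List.Properties using (map-tabulate)
  open import Data.Product using (_×_; _,_; proj₁; proj₂)
  open import Function using (id; _∘_)
  open import Relation.Nullary.Decidable using (⌊_⌋; yes)
  open import Relation.Nullary.Negation using (contradiction)
  open import Relation.Binary.PropositionalEquality
  open Sums
  open SubsetCliques
  open Edges

  ∑-allFin-suc : ∀ n (g : Fin (suc n) → ℕ) → ∑ (allFin (suc n)) g ≡ g fzero + ∑ (allFin n) (g ∘ fsuc)
  ∑-allFin-suc n g = cong (g fzero +_) (trans (cong (λ L → ∑ L g) (sym (map-tabulate id fsuc))) (∑-map (allFin n) fsuc g))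

  ∑-when-0 : ∀ {X : Set} (L : List X) (b : X → Bool) → ∑ L (λ x → when (b x) 0) ≡ 0
  ∑-when-0 []      b = refl
  ∑-when-0 (x ∷ L) b with b x
  ... | true  = ∑-when-0 L b
  ... | false = ∑-when-0 L b

  ∑-diagonal : ∀ n (u : Fin n) (f : Fin n → ℕ) → ∑ (allFin n) (λ v → when ⌊ u ≟ v ⌋ (f v)) ≡ f u
  ∑-diagonal (suc n) fzero    f =
    trans (∑-allFin-suc n (λ v → when ⌊ fzero ≟ v ⌋ (f v)))
          (trans (cong (f fzero +_) (trans (∑-const (allFin n) 0) (*-zeroʳ (length (allFin n))))) (+-identityʳ _))
  ∑-diagonal (suc n) (fsuc u) f =
    trans (∑-allFin-suc n (λ v → when ⌊ fsuc u ≟ v ⌋ (f v)))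
          (trans (∑-cong (allFin n) (λ v → cong (λ b → when b (f (fsuc v))) (≟-fsuc u v))) (∑-diagonal n u (f ∘ fsuc)))

  ∑-lookup : ∀ {n} (p : Subset n) → ∑ (allFin n) (λ u → when (lookup p u) 1) ≡ ∣ p ∣
  ∑-lookup {zero} [] = refl
  ∑-lookup {suc n} (b ∷ q) = trans (∑-allFin-suc n (λ u → when (lookup (b ∷ q) u) 1)) (head b)
    where
      head : ∀ b → when b 1 + ∑ (allFin n) (λ i → when (lookup q i) 1) ≡ ∣ b ∷ q ∣
      head true  = cong suc (∑-lookup q)
      head false = ∑-lookup q

  pair-split : ∀ x y a d → not (x ∧ (y ∧ not d)) ∨ a ≡ true → (d ≡ true → a ≡ false) →
               when a (when (x ∧ y) 1) + when ((x ∧ y) ∧ d) 1 ≡ when (x ∧ y) 1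
  pair-split false y     true  d     _  _   = refl
  pair-split false y     false d     _  _   = refl
  pair-split true  false true  d     _  _   = refl
  pair-split true  false false d     _  _   = refl
  pair-split true  true  true  true  _  irr = contradiction (irr refl) λ ()
  pair-split true  true  true  false _  _   = refl
  pair-split true  true  false true  _  _   = refl
  pair-split true  true  false false () _

  module _ {n : ℕ} (G : Graph n) where

    private
      V = allFin n

    ordered-pairs-in : Subset n → Fin n × Fin n → ℕ
    ordered-pairs-in p (u , v) = when (adj G u v) (when (lookup p u ∧ lookup p v) 1)

    ∑-ordered-pairs-in-clique : (p : Subset n) → isCliqueᵇ G p ≡ true →
      ∑ (allPairs n) (ordered-pairs-in p) + ∣ p ∣ ≡ ∣ p ∣ * ∣ p ∣
    ∑-ordered-pairs-in-clique p clique = begin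
        ∑ (allPairs n) (ordered-pairs-in p) + ∣ p ∣
      ≡⟨ cong₂ _+_ (∑-pairs V (ordered-pairs-in p)) (sym diagonal) ⟩
        ∑ V (λ u → ∑ V (λ v → when (adj G u v) (both u v))) + ∑ V (λ u → ∑ V (λ v → when ((P u ∧ P v) ∧ ⌊ u ≟ v ⌋) 1))
      ≡⟨ sym (∑-+ V _ _) ⟩
        ∑ V (λ u → ∑ V (λ v → when (adj G u v) (both u v)) + ∑ V (λ v → when ((P u ∧ P v) ∧ ⌊ u ≟ v ⌋) 1))
      ≡⟨ ∑-cong V (λ u → trans (sym (∑-+ V _ _)) (∑-cong V (λ v →
           pair-split (P u) (P v) (adj G u v) ⌊ u ≟ v ⌋ (pair u v) (loopless u v)))) ⟩
        ∑ V (λ u → ∑ V (λ v → both u v))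
      ≡⟨ ∑-cong V (λ u → trans (∑-cong V (λ v → when-∧ (P u) (P v))) (∑-*ˡ V (when (P u) 1) (λ v → when (P v) 1))) ⟩
        ∑ V (λ u → when (P u) 1 * ∑ V (λ v → when (P v) 1))
      ≡⟨ trans (∑-cong V (λ u → *-comm (when (P u) 1) _)) (∑-*ˡ V (∑ V (λ v → when (P v) 1)) (λ u → when (P u) 1)) ⟩
        ∑ V (λ v → when (P v) 1) * ∑ V (λ u → when (P u) 1)
      ≡⟨ cong₂ _*_ (∑-lookup p) (∑-lookup p) ⟩
        ∣ p ∣ * ∣ p ∣
      ∎
      where
        open ≡-Reasoning
        P = lookup p
        both : Fin n → Fin n → ℕ
        both u v = when (P u ∧ P v) 1
        when-∧ : ∀ x y → when (x ∧ y) 1 ≡ when x 1 * when y 1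
        when-∧ true  true  = refl
        when-∧ true  false = refl
        when-∧ false y     = refl
        diagonal : ∑ V (λ u → ∑ V (λ v → when ((P u ∧ P v) ∧ ⌊ u ≟ v ⌋) 1)) ≡ ∣ p ∣
        diagonal = trans (∑-cong V (λ u → trans (∑-cong V (λ v → when-∧-≟ (P u ∧ P v) ⌊ u ≟ v ⌋))
                                              (trans (∑-diagonal n u (both u)) (cong (λ b → when b 1) (∧-idem (P u))))))
                         (∑-lookup p)
          where
            when-∧-≟ : ∀ x d → when (x ∧ d) 1 ≡ when d (when x 1)
            when-∧-≟ true  true  = refl
            when-∧-≟ true  false = refl
            when-∧-≟ false true  = refl
            when-∧-≟ false false = refl
        pair : ∀ u v → cliquePair G p u v ≡ true
        pair u v = all-allFin-true (cliquePair G p u) (all-allFin-true _ (trans (sym (isCliqueᵇ-all G p)) clique) u) v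
        loopless : ∀ u v → ⌊ u ≟ v ⌋ ≡ true → adj G u v ≡ false
        loopless u v u≟v with u ≟ v
        loopless u .u refl | yes refl = irrefl G u

    through : ℕ → Fin n × Fin n → ℕ
    through s (u , v) = if adj G u v then kThrough s G u v else 0

    ∑-through : ∀ r → ∑ (allPairs n) (through (suc r)) ≡ suc r * r * k (suc r) G
    ∑-through r = begin
        ∑ (allPairs n) (through (suc r))
      ≡⟨ ∑-cong (allPairs n) through-as-∑ ⟩
        ∑ (allPairs n) (λ x → ∑ S (contains x))
      ≡⟨ ∑-swap (allPairs n) S contains ⟩
        ∑ S (λ p → ∑ (allPairs n) (λ x → contains x p))
      ≡⟨ ∑-cong S per-subset ⟩
        ∑ S (λ p → when ((∣ p ∣ ≡ᵇ suc r) ∧ isCliqueᵇ G p) (suc r * r))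
      ≡⟨ ∑-cong S (λ p → when-* ((∣ p ∣ ≡ᵇ suc r) ∧ isCliqueᵇ G p) (suc r * r)) ⟩
        ∑ S (λ p → suc r * r * when ((∣ p ∣ ≡ᵇ suc r) ∧ isCliqueᵇ G p) 1)
      ≡⟨ ∑-*ˡ S (suc r * r) _ ⟩
        suc r * r * k (suc r) G
      ∎
      where
        open ≡-Reasoning
        S = allSubsets n
        contains : Fin n × Fin n → Subset n → ℕ
        contains (u , v) p = when (adj G u v) (when ((∣ p ∣ ≡ᵇ suc r) ∧ isCliqueᵇ G p ∧ lookup p u ∧ lookup p v) 1)
        through-as-∑ : ∀ x → through (suc r) x ≡ ∑ S (contains x)
        through-as-∑ (u , v) with adj G u v
        ... | true  = refl
        ... | false = sym (∑-when-0 S (λ _ → false))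
        per-subset : ∀ p →
          ∑ (allPairs n) (λ x → when (adj G (proj₁ x) (proj₂ x))
                                     (when ((∣ p ∣ ≡ᵇ suc r) ∧ isCliqueᵇ G p ∧ lookup p (proj₁ x) ∧ lookup p (proj₂ x)) 1))
            ≡ when ((∣ p ∣ ≡ᵇ suc r) ∧ isCliqueᵇ G p) (suc r * r)
        per-subset p with ∣ p ∣ ≡ᵇ suc r in size | isCliqueᵇ G p in clique
        ... | false | _     = ∑-when-0 (allPairs n) (λ x → adj G (proj₁ x) (proj₂ x))
        ... | true  | false = ∑-when-0 (allPairs n) (λ x → adj G (proj₁ x) (proj₂ x))
        ... | true  | true  = +-cancelʳ-≡ (suc r) _ _ (begin
            ∑ (allPairs n) (ordered-pairs-in p) + suc r  ≡⟨ cong (∑ (allPairs n) (ordered-pairs-in p) +_) (sym ∣p∣≡1+r) ⟩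
            ∑ (allPairs n) (ordered-pairs-in p) + ∣ p ∣  ≡⟨ ∑-ordered-pairs-in-clique p clique ⟩
            ∣ p ∣ * ∣ p ∣                                ≡⟨ cong (λ m → m * m) ∣p∣≡1+r ⟩
            suc r * suc r                                ≡⟨ *-suc (suc r) r ⟩
            suc r + suc r * r                            ≡⟨ +-comm (suc r) _ ⟩
            suc r * r + suc r                            ∎)
          where
            ∣p∣≡1+r : ∣ p ∣ ≡ suc r
            ∣p∣≡1+r = ≡ᵇ⇒≡ ∣ p ∣ (suc r) (subst T (sym size) _)

    ∑-through-≤ : ∀ s → ∑ (allPairs n) (through s) ≤ js s G * (2 * e G)
    ∑-through-≤ s = begin
        ∑ (allPairs n) (through s)
      ≤⟨ ∑-≤-max (allPairs n) (through s) (λ { (u , v) → when (adj G u v) (js s G) }) (js s G) ≤-refl below-js ⟩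
        ∑ (allPairs n) (λ { (u , v) → when (adj G u v) (js s G) })
      ≡⟨ ∑-cong (allPairs n) (λ { (u , v) → when-* (adj G u v) (js s G) }) ⟩
        ∑ (allPairs n) (λ { (u , v) → js s G * when (adj G u v) 1 })
      ≡⟨ ∑-*ˡ (allPairs n) (js s G) _ ⟩
        js s G * ∑ (allPairs n) (λ { (u , v) → when (adj G u v) 1 })
      ≡⟨ cong (js s G *_) (∑-adjacent-pairs G) ⟩
        js s G * (2 * e G)
      ∎
      where
        open ≤-Reasoning
        below-js : ∀ x → through s x ≤ js s G → through s x ≤ when (adj G (proj₁ x) (proj₂ x)) (js s G)
        below-js (u , v) ≤js with adj G u v
        ... | true  = ≤js
        ... | false = z≤n

    cliques-≤-js : ∀ r → suc r * r * k (suc r) G ≤ js (suc r) G * (2 * e G)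
    cliques-≤-js r = subst (_≤ js (suc r) G * (2 * e G)) (∑-through r) (∑-through-≤ (suc r))

module Rationals where

  open import Defs using (frac; _^ℚ_)
  open import Data.Nat as ℕ using (ℕ; zero; suc; _^_)
  import Data.Nat.Properties as ℕ
  open import Data.Integer as ℤ using (+_)
  import Data.Integer.Properties as ℤ
  open import Data.Rational using (ℚ; _+_; _*_; _<_; _≤_; -_; toℚᵘ; Positive; NonNegative)
  open import Data.Rational.Properties
  open import Data.Rational.Unnormalised as ℚᵘ using (mkℚᵘ; _≃_; *≡*)
  import Data.Rational.Unnormalised.Properties as ℚᵘ
  open import Relation.Binary.PropositionalEquality
  open import Relation.Nullary using (yes; no)
  open import Relation.Nullary.Negation using (contradiction)
  open import Data.Integer.Tactic.RingSolver using (solve-∀)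
  open import Data.Rational.Solver using (module +-*-Solver)
  open +-*-Solver using (solve; _:+_; _:*_; :-_; _:=_)

  ι : ℕ → ℚ
  ι a = frac a 1

  private
    toℚᵘ-ι : ∀ a → toℚᵘ (ι a) ≃ mkℚᵘ (+ a) 0
    toℚᵘ-ι a = toℚᵘ-fromℚᵘ (mkℚᵘ (+ a) 0)

    toℚᵘ-frac : ∀ a b → toℚᵘ (frac a (suc b)) ≃ mkℚᵘ (+ a) b
    toℚᵘ-frac a b = toℚᵘ-fromℚᵘ (mkℚᵘ (+ a) b)

  ι-+ : ∀ a b → ι (a ℕ.+ b) ≡ ι a + ι b
  ι-+ a b = toℚᵘ-injective (ℚᵘ.≃-trans (toℚᵘ-ι (a ℕ.+ b)) (ℚᵘ.≃-trans unnormalised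
              (ℚᵘ.≃-sym (ℚᵘ.≃-trans (toℚᵘ-homo-+ (ι a) (ι b)) (ℚᵘ.+-cong (toℚᵘ-ι a) (toℚᵘ-ι b))))))
    where
      unnormalised : mkℚᵘ (+ (a ℕ.+ b)) 0 ≃ (mkℚᵘ (+ a) 0 ℚᵘ.+ mkℚᵘ (+ b) 0)
      unnormalised = *≡* (trans (cong (ℤ._* + 1) (ℤ.pos-+ a b)) (ring (+ a) (+ b)))
        where ring : ∀ x y → (x ℤ.+ y) ℤ.* + 1 ≡ (x ℤ.* + 1 ℤ.+ y ℤ.* + 1) ℤ.* + 1
              ring = solve-∀

  ι-* : ∀ a b → ι (a ℕ.* b) ≡ ι a * ι b
  ι-* a b = toℚᵘ-injective (ℚᵘ.≃-trans (toℚᵘ-ι (a ℕ.* b)) (ℚᵘ.≃-trans unnormalised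
              (ℚᵘ.≃-sym (ℚᵘ.≃-trans (toℚᵘ-homo-* (ι a) (ι b)) (ℚᵘ.*-cong (toℚᵘ-ι a) (toℚᵘ-ι b))))))
    where
      unnormalised : mkℚᵘ (+ (a ℕ.* b)) 0 ≃ (mkℚᵘ (+ a) 0 ℚᵘ.* mkℚᵘ (+ b) 0)
      unnormalised = *≡* (cong (ℤ._* + 1) (ℤ.pos-* a b))

  frac-*-denominator : ∀ a b → frac a (suc b) * ι (suc b) ≡ ι a
  frac-*-denominator a b = toℚᵘ-injective (ℚᵘ.≃-trans (ℚᵘ.≃-trans (toℚᵘ-homo-* (frac a (suc b)) (ι (suc b)))
                              (ℚᵘ.*-cong (toℚᵘ-frac a b) (toℚᵘ-ι (suc b)))) (ℚᵘ.≃-trans unnormalised (ℚᵘ.≃-sym (toℚᵘ-ι a))))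
    where
      unnormalised : (mkℚᵘ (+ a) b ℚᵘ.* mkℚᵘ (+ suc b) 0) ≃ mkℚᵘ (+ a) 0
      unnormalised = *≡* (trans (ring (+ a) (+ suc b)) (cong (λ z → + a ℤ.* + suc z) (sym (ℕ.*-identityʳ b))))
        where ring : ∀ x y → (x ℤ.* y) ℤ.* + 1 ≡ x ℤ.* y
              ring = solve-∀

  ι-^ : ∀ a m → ι a ^ℚ m ≡ ι (a ^ m)
  ι-^ a zero    = refl
  ι-^ a (suc m) = trans (cong (ι a *_) (ι-^ a m)) (sym (ι-* a (a ^ m)))

  frac-^-*-denominator : ∀ a b m → frac a (suc b) ^ℚ m * ι (suc b ^ m) ≡ ι (a ^ m)
  frac-^-*-denominator a b zero    = *-identityˡ (ι 1)
  frac-^-*-denominator a b (suc m) = begin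
      (F * F ^ℚ m) * ι (suc b ℕ.* suc b ^ m)    ≡⟨ cong ((F * F ^ℚ m) *_) (ι-* (suc b) (suc b ^ m)) ⟩
      (F * F ^ℚ m) * (ι (suc b) * ι (suc b ^ m)) ≡⟨ interchange F (F ^ℚ m) (ι (suc b)) (ι (suc b ^ m)) ⟩
      (F * ι (suc b)) * (F ^ℚ m * ι (suc b ^ m)) ≡⟨ cong₂ _*_ (frac-*-denominator a b) (frac-^-*-denominator a b m) ⟩
      ι a * ι (a ^ m)                            ≡⟨ sym (ι-* a (a ^ m)) ⟩
      ι (a ℕ.* a ^ m)                            ∎
    where
      open ≡-Reasoning
      F = frac a (suc b)
      interchange : ∀ x y z w → (x * y) * (z * w) ≡ (x * z) * (y * w)
      interchange = solve 4 (λ x y z w → (x :* y) :* (z :* w) := (x :* z) :* (y :* w)) refl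

  ι-nonNegative : ∀ a → NonNegative (ι a)
  ι-nonNegative a = normalize-nonNeg a 1

  ι-positive : ∀ a → 0 ℕ.< a → Positive (ι a)
  ι-positive (suc a) _ = normalize-pos (suc a) 1

  ι-mono-≤ : ∀ {a b} → a ℕ.≤ b → ι a ≤ ι b
  ι-mono-≤ {a} {b} a≤b = subst (ι a ≤_) (trans (sym (ι-+ a (b ℕ.∸ a))) (cong ι (ℕ.m+[n∸m]≡n a≤b)))
    (subst (_≤ ι a + ι (b ℕ.∸ a)) (+-identityʳ (ι a))
      (+-monoʳ-≤ (ι a) (nonNegative⁻¹ (ι (b ℕ.∸ a)) {{ι-nonNegative (b ℕ.∸ a)}})))

  ι-cancel-< : ∀ {a b} → ι a < ι b → a ℕ.< b
  ι-cancel-< {a} {b} ιa<ιb with a ℕ.<? b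
  ... | yes a<b = a<b
  ... | no  a≮b = contradiction (<-≤-trans ιa<ιb (ι-mono-≤ (ℕ.≮⇒≥ a≮b))) (<-irrefl refl)

  <-by-scaling : ∀ (q : ℚ) m z → 0 ℕ.< z → q * ι z < ι (m ℕ.* z) → q < ι m
  <-by-scaling q m z z>0 scaled =
    *-cancelʳ-<-nonNeg (ι z) {{ι-nonNegative z}} (subst (q * ι z <_) (ι-* m z) scaled)

  +-cancelˡ-< : ∀ x {p q} → x + p < x + q → p < q
  +-cancelˡ-< x {p} {q} x+p<x+q = subst₂ _<_ (cancel p) (cancel q) (+-monoʳ-< (- x) x+p<x+q)
    where
      cancel : ∀ p → (- x) + (x + p) ≡ p
      cancel p = solve 2 (λ x p → (:- x) :+ (x :+ p) := p) refl x p

module Bounds where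

  open import Defs hiding (sym)
  open import Data.Nat as ℕ using (ℕ; suc; _∸_; _^_)
  import Data.Nat.Properties as ℕ
  open import Data.List using (allFin; length)
  open import Data.List.Properties using (length-tabulate)
  open import Data.Rational using (ℚ; 0ℚ; _<_; _>_; _≤_; _+_; _*_; Positive; NonNegative; positive)
  open import Data.Rational.Properties
  open import Function using (id)
  open import Relation.Binary.PropositionalEquality
  open import Data.Nat.Tactic.RingSolver using (solve-∀)
  open import Data.Rational.Solver using (module +-*-Solver)
  open +-*-Solver using (solve; _:+_; _:*_; _:=_)
  open Cliques using (module SimpleGraph)
  open Edges
  open SubsetCliques using (k≡cliques)
  open Jointsize using (cliques-≤-js)
  open Rationals
  open import Algebra.Properties.CommutativeSemigroup ℕ.*-commutativeSemigroup using (x∙yz≈y∙xz; x∙yz≈xz∙y; xy∙z≈xz∙y)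

  module _ (r′ : ℕ) (c : ℚ) (c>0 : c > 0ℚ) (n : ℕ) (G : Graph n)
           (dense : frac (e G) 1 > (frac r′ (2 ℕ.* suc r′) + c) * (frac n 1 ^ℚ 2)) where

    private
      r = suc r′
      K = k (suc r) G
      Q = c * ι (2 ℕ.* r) * ι (n ℕ.* n)
      instance
        2r-positive : Positive (ι (2 ℕ.* r))
        2r-positive = ι-positive (2 ℕ.* r) ℕ.z<s
        c-nonNegative : NonNegative c
        c-nonNegative = pos⇒nonNeg c {{positive c>0}}
        c*2r-nonNegative : NonNegative (c * ι (2 ℕ.* r))
        c*2r-nonNegative = nonNeg*nonNeg⇒nonNeg c (ι (2 ℕ.* r)) {{ι-nonNegative (2 ℕ.* r)}}
        n²-nonNegative : NonNegative (ι (n ℕ.* n))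
        n²-nonNegative = ι-nonNegative (n ℕ.* n)

      Q≥0 : 0ℚ ≤ Q
      Q≥0 = nonNegative⁻¹ Q {{nonNeg*nonNeg⇒nonNeg (c * ι (2 ℕ.* r)) (ι (n ℕ.* n))}}

      cleared : ι (r′ ℕ.* (n ℕ.* n)) + Q < ι (e G ℕ.* (2 ℕ.* r))
      cleared = subst₂ _<_ lhs (sym (ι-* (e G) (2 ℕ.* r))) (*-monoˡ-<-pos (ι (2 ℕ.* r)) dense′)
        where
          dense′ : (frac r′ (2 ℕ.* r) + c) * ι (n ℕ.* n) < ι (e G)
          dense′ = subst (λ z → (frac r′ (2 ℕ.* r) + c) * z < ι (e G))
                         (trans (ι-^ n 2) (cong (λ m → ι (n ℕ.* m)) (ℕ.*-identityʳ n))) dense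
          expand : ∀ α c N T → (α + c) * N * T ≡ (α * T) * N + c * T * N
          expand = solve 4 (λ α c N T → (α :+ c) :* N :* T := (α :* T) :* N :+ c :* T :* N) refl
          lhs : (frac r′ (2 ℕ.* r) + c) * ι (n ℕ.* n) * ι (2 ℕ.* r) ≡ ι (r′ ℕ.* (n ℕ.* n)) + Q
          lhs = trans (expand (frac r′ (2 ℕ.* r)) c (ι (n ℕ.* n)) (ι (2 ℕ.* r)))
                      (cong (_+ Q) (trans (cong (_* ι (n ℕ.* n)) (frac-*-denominator r′ (ℕ.pred (2 ℕ.* r))))
                                          (sym (ι-* r′ (n ℕ.* n)))))

      sparse<edges : r′ ℕ.* (n ℕ.* n) ℕ.< e G ℕ.* (2 ℕ.* r)
      sparse<edges = ι-cancel-< (≤-<-trans (subst (_≤ ι (r′ ℕ.* (n ℕ.* n)) + Q) (+-identityʳ _)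
                                                 (+-monoʳ-≤ (ι (r′ ℕ.* (n ℕ.* n))) Q≥0))
                                          cleared)

      D = e G ℕ.* (2 ℕ.* r) ∸ r′ ℕ.* (n ℕ.* n)

      edges≡ : r′ ℕ.* (n ℕ.* n) ℕ.+ D ≡ e G ℕ.* (2 ℕ.* r)
      edges≡ = ℕ.m+[n∸m]≡n (ℕ.<⇒≤ sparse<edges)

      Q<D : Q < ι D
      Q<D = +-cancelˡ-< (ι (r′ ℕ.* (n ℕ.* n)))
              (subst (ι (r′ ℕ.* (n ℕ.* n)) + Q <_) (trans (cong ι (sym edges≡)) (ι-+ (r′ ℕ.* (n ℕ.* n)) D)) cleared)

      n>0 : 0 ℕ.< n
      n>0 = ℕ.n≢0⇒n>0 λ { refl → ℕ.n≮0 (subst (λ m → r′ ℕ.* 0 ℕ.< m ℕ.* (2 ℕ.* r)) (e-empty G) sparse<edges) }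
        where
          e-empty : (G : Graph 0) → e G ≡ 0
          e-empty G = ℕ.n≤0⇒n≡0 (ℕ.≤-trans (ℕ.m≤m+n (e G) _) (2*e≤n² G))

      open SimpleGraph (adj G) (Graph.sym G) (irrefl G)

      V = allFin n

      |V| : length V ≡ n
      |V| = length-tabulate id

      edges′ : 2 ℕ.* r ℕ.* cliques 2 V ≡ r′ ℕ.* (length V ℕ.* length V) ℕ.+ D
      edges′ rewrite |V| | sym (e≡cliques-2 G) = trans (ℕ.*-comm (2 ℕ.* r) (e G)) (sym edges≡)

      supersaturation : D ℕ.* n ^ r ℕ.≤ r ^ r ℕ.* (suc r ℕ.* (n ℕ.* K))
      supersaturation = begin
          D ℕ.* n ^ r
        ≡⟨ cong (λ m → D ℕ.* m ^ r) (sym |V|) ⟩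
          D ℕ.* length V ^ r
        ≤⟨ ℕ.*-monoʳ-≤ D (power-≤-cliques V r′ (subst (r′ ℕ.* (length V ℕ.* length V) ℕ.≤_) (sym edges′) (ℕ.m≤m+n _ D))) ⟩
          D ℕ.* (r ^ r ℕ.* cliques r V)
        ≡⟨ x∙yz≈y∙xz D (r ^ r) (cliques r V) ⟩
          r ^ r ℕ.* (D ℕ.* cliques r V)
        ≤⟨ ℕ.*-monoʳ-≤ (r ^ r) (excess-≤-cliques V r′ D edges′) ⟩
          r ^ r ℕ.* (suc r ℕ.* (length V ℕ.* cliques (suc r) V))
        ≡⟨ cong₂ (λ m K → r ^ r ℕ.* (suc r ℕ.* (m ℕ.* K))) |V| (sym (k≡cliques (suc r) G)) ⟩
          r ^ r ℕ.* (suc r ℕ.* (n ℕ.* K))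
        ∎
        where open ℕ.≤-Reasoning

      instance
        n-nonZero : ℕ.NonZero n
        n-nonZero = ℕ.>-nonZero n>0

      ι-scale : ∀ x a b d → x * ι a * ι b * ι d ≡ x * ι (a ℕ.* b ℕ.* d)
      ι-scale x a b d = begin-equality
          x * ι a * ι b * ι d       ≡⟨ solve 4 (λ x a b d → x :* a :* b :* d := x :* (a :* b :* d)) refl x (ι a) (ι b) (ι d) ⟩
          x * (ι a * ι b * ι d)     ≡⟨ cong (x *_) (trans (cong (_* ι d) (sym (ι-* a b))) (sym (ι-* (a ℕ.* b) d))) ⟩
          x * ι (a ℕ.* b ℕ.* d)     ∎
        where open ≤-Reasoning

      JS = js (suc r) G

      JS-lower-bound : suc r ℕ.* r ^ r′ ℕ.* K ℕ.≤ JS ℕ.* (r ^ r′ ℕ.* (n ℕ.* n))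
      JS-lower-bound = begin
          suc r ℕ.* r ^ r′ ℕ.* K          ≡⟨ xy∙z≈xz∙y (suc r) (r ^ r′) K ⟩
          suc r ℕ.* K ℕ.* r ^ r′          ≤⟨ ℕ.*-monoˡ-≤ (r ^ r′) (ℕ.*-monoˡ-≤ K (ℕ.m≤m*n (suc r) r)) ⟩
          suc r ℕ.* r ℕ.* K ℕ.* r ^ r′    ≤⟨ ℕ.*-monoˡ-≤ (r ^ r′) (cliques-≤-js G r) ⟩
          JS ℕ.* (2 ℕ.* e G) ℕ.* r ^ r′    ≤⟨ ℕ.*-monoˡ-≤ (r ^ r′) (ℕ.*-monoʳ-≤ JS (2*e≤n² G)) ⟩
          JS ℕ.* (n ℕ.* n) ℕ.* r ^ r′      ≡⟨ x∙yz≈xz∙y JS (r ^ r′) (n ℕ.* n) ⟨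
          JS ℕ.* (r ^ r′ ℕ.* (n ℕ.* n))    ∎
        where open ℕ.≤-Reasoning

    key : ι 2 * c * ι (n ^ suc r) < ι (suc r ℕ.* r ^ r′ ℕ.* K)
    key = <-by-scaling (ι 2 * c * ι (n ^ suc r)) (suc r ℕ.* r ^ r′ ℕ.* K) (r ℕ.* n) (ℕ.>-nonZero⁻¹ (r ℕ.* n) {{ℕ.m*n≢0 r n}}) (begin-strict
        ι 2 * c * ι (n ^ suc r) * ι (r ℕ.* n)
      ≡⟨ trans (cong (λ x → x * ι (n ^ suc r) * ι (r ℕ.* n)) (*-comm (ι 2) c)) (ι-scale c 2 (n ^ suc r) (r ℕ.* n)) ⟩
        c * ι (2 ℕ.* n ^ suc r ℕ.* (r ℕ.* n))
      ≡⟨ cong (λ m → c * ι m) (regroup r n (n ^ r)) ⟩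
        c * ι (2 ℕ.* r ℕ.* (n ℕ.* n) ℕ.* n ^ r)
      ≡⟨ sym (ι-scale c (2 ℕ.* r) (n ℕ.* n) (n ^ r)) ⟩
        Q * ι (n ^ r)
      <⟨ *-monoˡ-<-pos (ι (n ^ r)) {{ι-positive (n ^ r) (ℕ.m^n>0 n r)}} Q<D ⟩
        ι D * ι (n ^ r)
      ≡⟨ sym (ι-* D (n ^ r)) ⟩
        ι (D ℕ.* n ^ r)
      ≤⟨ ι-mono-≤ supersaturation ⟩
        ι (r ^ r ℕ.* (suc r ℕ.* (n ℕ.* K)))
      ≡⟨ cong ι (regroup′ r (r ^ r′) n K) ⟩
        ι (suc r ℕ.* r ^ r′ ℕ.* K ℕ.* (r ℕ.* n))
      ∎)
      where
        open ≤-Reasoning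
        regroup : ∀ r n P → 2 ℕ.* (n ℕ.* P) ℕ.* (r ℕ.* n) ≡ 2 ℕ.* r ℕ.* (n ℕ.* n) ℕ.* P
        regroup = solve-∀
        regroup′ : ∀ r P n K → r ℕ.* P ℕ.* (suc r ℕ.* (n ℕ.* K)) ≡ suc r ℕ.* P ℕ.* K ℕ.* (r ℕ.* n)
        regroup′ = solve-∀

    cliques-bound : ι 2 * c * frac r (suc r) * (frac n r ^ℚ suc r) < ι K
    cliques-bound = <-by-scaling q K (suc r ℕ.* r ^ suc r) (ℕ.>-nonZero⁻¹ _ {{ℕ.m*n≢0 (suc r) (r ^ suc r) {{_}} {{ℕ.m^n≢0 r (suc r)}}}}) (begin-strict
        q * ι (suc r ℕ.* r ^ suc r)
      ≡⟨ cong (q *_) (ι-* (suc r) (r ^ suc r)) ⟩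
        q * (ι (suc r) * ι (r ^ suc r))
      ≡⟨ regroup (ι 2 * c) (frac r (suc r)) (frac n r ^ℚ suc r) (ι (suc r)) (ι (r ^ suc r)) ⟩
        ι 2 * c * (frac r (suc r) * ι (suc r)) * (frac n r ^ℚ suc r * ι (r ^ suc r))
      ≡⟨ cong₂ (λ a b → ι 2 * c * a * b) (frac-*-denominator r r) (frac-^-*-denominator n r′ (suc r)) ⟩
        ι 2 * c * ι r * ι (n ^ suc r)
      ≡⟨ swap (ι 2 * c) (ι r) (ι (n ^ suc r)) ⟩
        ι 2 * c * ι (n ^ suc r) * ι r
      <⟨ *-monoˡ-<-pos (ι r) {{ι-positive r ℕ.z<s}} key ⟩
        ι (suc r ℕ.* r ^ r′ ℕ.* K) * ι r
      ≡⟨ sym (ι-* (suc r ℕ.* r ^ r′ ℕ.* K) r) ⟩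
        ι (suc r ℕ.* r ^ r′ ℕ.* K ℕ.* r)
      ≤⟨ ι-mono-≤ (ℕ.≤-trans (ℕ.m≤m*n (suc r ℕ.* r ^ r′ ℕ.* K ℕ.* r) r) (ℕ.≤-reflexive (regroup′ r (r ^ r′) K))) ⟩
        ι (K ℕ.* (suc r ℕ.* r ^ suc r))
      ∎)
      where
        open ≤-Reasoning
        q = ι 2 * c * frac r (suc r) * (frac n r ^ℚ suc r)
        regroup : ∀ x a b u v → x * a * b * (u * v) ≡ x * (a * u) * (b * v)
        regroup = solve 5 (λ x a b u v → x :* a :* b :* (u :* v) := x :* (a :* u) :* (b :* v)) refl
        swap : ∀ x a b → x * a * b ≡ x * b * a
        swap = solve 3 (λ x a b → x :* a :* b := x :* b :* a) refl
        regroup′ : ∀ r P K → suc r ℕ.* P ℕ.* K ℕ.* r ℕ.* r ≡ K ℕ.* (suc r ℕ.* (r ℕ.* (r ℕ.* P)))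
        regroup′ = solve-∀

    jointsize-bound : ι 2 * c * (frac n r ^ℚ r′) < ι (js (suc r) G)
    jointsize-bound = <-by-scaling q JS (r ^ r′ ℕ.* (n ℕ.* n)) (ℕ.>-nonZero⁻¹ _ {{ℕ.m*n≢0 (r ^ r′) (n ℕ.* n) {{ℕ.m^n≢0 r r′}} {{ℕ.m*n≢0 n n}}}}) (begin-strict
        q * ι (r ^ r′ ℕ.* (n ℕ.* n))
      ≡⟨ cong (q *_) (ι-* (r ^ r′) (n ℕ.* n)) ⟩
        q * (ι (r ^ r′) * ι (n ℕ.* n))
      ≡⟨ regroup (ι 2 * c) (frac n r ^ℚ r′) (ι (r ^ r′)) (ι (n ℕ.* n)) ⟩
        ι 2 * c * (frac n r ^ℚ r′ * ι (r ^ r′)) * ι (n ℕ.* n)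
      ≡⟨ cong (λ a → ι 2 * c * a * ι (n ℕ.* n)) (frac-^-*-denominator n r′ r′) ⟩
        ι 2 * c * ι (n ^ r′) * ι (n ℕ.* n)
      ≡⟨ trans (*-assoc (ι 2 * c) _ _) (cong (ι 2 * c *_) (sym (ι-* (n ^ r′) (n ℕ.* n)))) ⟩
        ι 2 * c * ι (n ^ r′ ℕ.* (n ℕ.* n))
      ≡⟨ cong (λ m → ι 2 * c * ι m) (power-regroup n (n ^ r′)) ⟩
        ι 2 * c * ι (n ^ suc r)
      <⟨ key ⟩
        ι (suc r ℕ.* r ^ r′ ℕ.* K)
      ≤⟨ ι-mono-≤ JS-lower-bound ⟩
        ι (JS ℕ.* (r ^ r′ ℕ.* (n ℕ.* n)))
      ∎)
      where
        open ≤-Reasoning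
        q = ι 2 * c * (frac n r ^ℚ r′)
        regroup : ∀ x a u v → x * a * (u * v) ≡ x * (a * u) * v
        regroup = solve 4 (λ x a u v → x :* a :* (u :* v) := x :* (a :* u) :* v) refl
        power-regroup : ∀ n P → P ℕ.* (n ℕ.* n) ≡ n ℕ.* (n ℕ.* P)
        power-regroup = solve-∀

open import Defs
open import Data.Nat using (ℕ; _≤_; _+_; _∸_; _*_)
open import Data.Rational using (ℚ; _<_; _>_; 0ℚ)
open import Data.Rational renaming (_+_ to _+ℚ_; _*_ to _*ℚ_) using ()
open import Data.Product using (_×_)
open import Data.Nat using (suc)
open import Data.Nat.Properties using (+-comm)
open import Data.Product using (_,_)
open Bounds using (cliques-bound; jointsize-bound)

-- The hypothesis 3 ≤ r only serves to exclude r = 0.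
lemma1 : (r : ℕ) → 3 ≤ r → (c : ℚ) → c > 0ℚ → (n : ℕ) → (G : Graph n) →
    frac (e G) 1 > (frac (r ∸ 1) (2 * r) +ℚ c) *ℚ (frac n 1 ^ℚ 2) →
    (frac (k (r + 1) G) 1 > frac 2 1 *ℚ c *ℚ frac r (r + 1) *ℚ (frac n r ^ℚ (r + 1)))
    × (frac (js (r + 1) G) 1 > frac 2 1 *ℚ c *ℚ (frac n r ^ℚ (r ∸ 1)))
lemma1 (suc r′) _ c c>0 n G dense rewrite +-comm r′ 1 =
  cliques-bound r′ c c>0 n G dense , jointsize-bound r′ c c>0 n G dense
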